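{- Let $K\geq 1$ be an integer. For every integer $m>1$ there exists an integer $N\geq 0$ such that either $\pi_K^N(m)$ is a fixed point of $\pi_K$ (i.e. $\pi_K(\pi_K^N(m))=\pi_K^N(m)$), or $K\equiv 3\pmod 6$ and $\pi_K^N(m)\in\{2,3\}$. Moreover, when $K\equiv 3 \pmod 6$, one has $\pi_K(2)=3$ and $\pi_K(3)=2$, so $(2,3)$ is a $2$-periodic point.
   Context: For a positive integer $K$, the $K$-Fibonacci sequence is defined by $F_{K,0}=0$, $F_{K,1}=1$, $F_{K,n}=K F_{K,n-1}+F_{K,n-2}$. For an integer $m>1$ this sequence is periodic modulo $m$, and $\pi_K(m)$ denotes the length of its shortest period modulo $m$ (the $K$-Pisano period). Iterates are $\pi_K^1=\pi_K$, $\pi_K^{i+1}(m)=\pi_K(\pi_K^{i}(m))$, and $\pi_K^0(m)=m$. A fixed point is an integer $m>1$ with $\pi_K(m)=m$. -}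

module Defs where

open import Data.Nat using (ℕ; zero; suc; _+_; _*_; _≤_; _<_)
open import Data.Integer as ℤ using (ℤ; +_; _-_)
open import Data.Integer.Divisibility using (_∣_)
open import Data.Product using (_×_)

kfib : ℕ → ℕ → ℕ
kfib K zero = 0
kfib K (suc zero) = 1
kfib K (suc (suc n)) = K * kfib K (suc n) + kfib K n

_≡_[mod_] : ℕ → ℕ → ℕ → Set
a ≡ b [mod m ] = (+ m) ∣ ((+ a) - (+ b))

IsPeriod : ℕ → ℕ → ℕ → Set
IsPeriod K m p = 0 < p × (∀ n → kfib K (n + p) ≡ kfib K n [mod m ])

IsPisano : ℕ → ℕ → ℕ → Set
IsPisano K m p = IsPeriod K m p × (∀ q → IsPeriod K m q → p ≤ q)

data PisanoIter (K m : ℕ) : ℕ → ℕ → Set where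
  iter-zero : PisanoIter K m zero m
  iter-suc  : ∀ {N r s} → PisanoIter K m N r → IsPisano K r s → PisanoIter K m (suc N) s

-- Write π for π_K. Periods modulo m are the q with F q ≡ 0 and F (q + 1) ≡ 1, and they are the
-- multiples of π(m); hence π(lcm a b) = lcm (π a) (π b), and for a prime p, π(p^(e+1)) divides
-- p^e · π(p). For p ≥ 5, π(p) divides 4z where z ≤ p + 1 is the first index with p ∣ F z, so
-- π(p^(e+1)) = p^k · w with k ≤ e + 1 and all prime factors of w below p; for p = 2, 3 the same
-- holds by direct computation modulo 2, 3, 4, 8. Call m settled if π m = m or m lies on the 2-cycle
-- 2 ↔ 3 (which exists exactly when K ≡ 3 mod 6). Settling eventually is preserved by lcm, and if
-- π(p^(e+1)) = lcm (p^(e+1)) w, the orbit of p^(e+1) is the running lcm with the orbit of w, which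
-- stops growing once that orbit is settled. Induction on the largest prime factor finishes the proof.

module Submission where

open import Defs
open import Data.Nat using (ℕ; zero; suc; _+_; _*_; _∸_; _^_; _%_; _/_; _≤_; _<_; z≤n; s≤s; _<?_; _≟_;
  NonZero; NonTrivial; >-nonZero; ≢-nonZero; ≢-nonZero⁻¹; nonTrivial⇒n>1)
import Data.Nat.Properties as ℕ
open import Data.Nat.DivMod using (m≡m%n+[m/n]*n; m%n<n; m∣n⇒o%n%m≡o%m)
open import Data.Nat.Divisibility
open import Data.Nat.Coprimality using (Coprime; coprime-divisor; coprime⇒gcd≡1; coprime-Bézout)
  renaming (sym to Coprime-sym)
open import Data.Nat.GCD using (gcd; module Bézout)
open import Data.Nat.LCM using (lcm; lcm-least; lcm-comm; m∣lcm[m,n]; n∣lcm[m,n]; gcd*lcm)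
open import Data.Nat.Induction using (<-rec)
open import Data.Nat.Primality using (Prime; prime?; prime[2]; ¬prime[1]; prime⇒irreducible; prime⇒nonZero;
  prime⇒nonTrivial; euclidsLemma; composite⇒¬prime; composite[4])
open import Data.Nat.Primality.Factorisation using (factorise)
open import Data.Nat.ListAction using (product)
open import Data.List using ([]; _∷_)
open import Data.List.Relation.Unary.All using (_∷_)
open import Data.Integer using (ℤ; +_; 0ℤ; 1ℤ; -1ℤ; _%ℕ_; _/ℕ_)
  renaming (_+_ to _+ᶻ_; _*_ to _*ᶻ_; _-_ to _-ᶻ_; -_ to -ᶻ_; _^_ to _^ᶻ_)
import Data.Integer.Properties as ℤ
open import Data.Integer.DivMod using (a≡a%ℕn+[a/ℕn]*n; n%ℕd<d)
import Data.Integer.Divisibility.Signed as Signed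
open import Data.Integer.Tactic.RingSolver using (solve-∀)
open import Data.Fin as Fin using (Fin; toℕ; fromℕ<; combine)
open import Data.Fin.Properties using (toℕ-fromℕ<; toℕ<n; pigeonhole; combine-injective; all?)
open import Data.Product using (_×_; _,_; proj₁; proj₂; ∃; ∃₂; ∃-syntax)
open import Data.Sum using (_⊎_; inj₁; inj₂; [_,_]′)
open import Data.Empty using (⊥)
open import Relation.Nullary using (¬_; Dec; yes; no; contradiction)
open import Relation.Nullary.Decidable using (_×-dec_; _→-dec_; ¬?; True; toWitness; toWitnessFalse)
import Relation.Nullary.Decidable as Dec
open import Relation.Unary using (Decidable)
open import Relation.Binary.Bundles using (Setoid)
open import Relation.Binary.Structures using (IsEquivalence)
import Relation.Binary.Reasoning.Setoid as SetoidReasoning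
open import Relation.Binary.PropositionalEquality
  using (_≡_; _≢_; refl; sym; trans; cong; cong₂; subst; subst₂; module ≡-Reasoning)

-- Arithmetic of natural numbers

Least : (ℕ → Set) → ℕ → Set
Least P n = P n × (∀ k → k < n → ¬ P k)

first-below : ∀ {P} → Decidable P → ∀ n → (∃[ k ] (k < n × Least P k)) ⊎ (∀ k → k < n → ¬ P k)
first-below P? zero = inj₂ λ _ ()
first-below P? (suc n) with first-below P? n
... | inj₁ (k , k<n , least-k) = inj₁ (k , ℕ.m<n⇒m<1+n k<n , least-k)
... | inj₂ none with P? n
...   | yes Pn = inj₁ (n , ℕ.n<1+n n , Pn , none)
...   | no ¬Pn = inj₂ λ k k<1+n → [ none k , (λ { refl → ¬Pn }) ]′ (ℕ.m<1+n⇒m<n∨m≡n k<1+n)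

least : ∀ {P} → Decidable P → ∀ {n} → P n → ∃ (Least P)
least P? {n} Pn with first-below P? n
... | inj₁ (k , _ , least-k) = k , least-k
... | inj₂ none = n , Pn , none

n∣m⇒lcm[m,n]≡m : ∀ {m n} → n ∣ m → lcm m n ≡ m
n∣m⇒lcm[m,n]≡m {m} {n} n∣m = ∣-antisym (lcm-least ∣-refl n∣m) (m∣lcm[m,n] m n)

coprime⇒lcm≡* : ∀ {m n} → Coprime m n → lcm m n ≡ m * n
coprime⇒lcm≡* {m} {n} c = begin
  lcm m n            ≡⟨ sym (ℕ.*-identityˡ (lcm m n)) ⟩
  1 * lcm m n        ≡⟨ cong (_* lcm m n) (sym (coprime⇒gcd≡1 c)) ⟩
  gcd m n * lcm m n  ≡⟨ gcd*lcm m n ⟩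
  m * n              ∎
  where open ≡-Reasoning

lcm≢0 : ∀ m n .{{_ : NonZero m}} .{{_ : NonZero n}} → NonZero (lcm m n)
lcm≢0 m n = ≢-nonZero λ lcm≡0 → ≢-nonZero⁻¹ (m * n) {{ℕ.m*n≢0 m n}} (begin
  m * n              ≡⟨ sym (gcd*lcm m n) ⟩
  gcd m n * lcm m n  ≡⟨ cong (gcd m n *_) lcm≡0 ⟩
  gcd m n * 0        ≡⟨ ℕ.*-zeroʳ (gcd m n) ⟩
  0                  ∎)
  where open ≡-Reasoning

coprime-^ : ∀ {m n} → Coprime m n → ∀ e → Coprime (m ^ e) n
coprime-^ {m} {n} m⊥n e {d} (d∣m^e , d∣n) = go e d∣m^e
  where
  d⊥m : Coprime d m
  d⊥m (c∣d , c∣m) = m⊥n (c∣m , ∣-trans c∣d d∣n)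
  go : ∀ e → d ∣ m ^ e → d ≡ 1
  go zero    d∣1     = ∣1⇒≡1 d∣1
  go (suc e) d∣m^1+e = go e (coprime-divisor d⊥m d∣m^1+e)

prime∤⇒coprime : ∀ {p n} → Prime p → ¬ p ∣ n → Coprime p n
prime∤⇒coprime pp p∤n (d∣p , d∣n) with prime⇒irreducible pp d∣p
... | inj₁ d≡1 = d≡1
... | inj₂ refl = contradiction d∣n p∤n

prime∣prime⇒≡ : ∀ {p q} → Prime p → Prime q → p ∣ q → p ≡ q
prime∣prime⇒≡ pp pq p∣q with prime⇒irreducible pq p∣q
... | inj₁ refl = contradiction pp ¬prime[1]
... | inj₂ p≡q = p≡q

prime∣^⇒∣ : ∀ {q p} → Prime q → ∀ e → q ∣ p ^ e → q ∣ p
prime∣^⇒∣ pq zero    q∣1 = contradiction (subst Prime (∣1⇒≡1 q∣1) pq) ¬prime[1]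
prime∣^⇒∣ pq (suc e) q∣p^1+e with euclidsLemma _ _ pq q∣p^1+e
... | inj₁ q∣p   = q∣p
... | inj₂ q∣p^e = prime∣^⇒∣ pq e q∣p^e

∃-prime-divisor : ∀ {n} → 1 < n → ∃[ q ] (Prime q × q ∣ n)
∃-prime-divisor {n@(suc _)} 1<n with factorise n
... | record { factors = [] ; isFactorisation = n≡1 } = contradiction n≡1 (ℕ.>⇒≢ 1<n)
... | record { factors = q ∷ qs ; isFactorisation = n≡q*Πqs ; factorsPrime = pq ∷ _ } =
  q , pq , subst (q ∣_) (sym n≡q*Πqs) (m∣m*n (product qs))

^-monoʳ-∣ : ∀ p {m n} → m ≤ n → p ^ m ∣ p ^ n
^-monoʳ-∣ p {m} {n} m≤n = divides (p ^ (n ∸ m)) (begin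
  p ^ n                  ≡⟨ cong (p ^_) (sym (ℕ.m+[n∸m]≡n m≤n)) ⟩
  p ^ (m + (n ∸ m))      ≡⟨ ℕ.^-distribˡ-+-* p m (n ∸ m) ⟩
  p ^ m * p ^ (n ∸ m)    ≡⟨ ℕ.*-comm (p ^ m) (p ^ (n ∸ m)) ⟩
  p ^ (n ∸ m) * p ^ m    ∎)
  where open ≡-Reasoning

factor-out : ∀ p .{{_ : NonTrivial p}} n .{{_ : NonZero n}} → ∃[ e ] ∃[ u ] (n ≡ p ^ e * u × ¬ p ∣ u)
factor-out p n = <-rec (λ n → .{{_ : NonZero n}} → Split n) step n
  where
  Split : ℕ → Set
  Split n = ∃[ e ] ∃[ u ] (n ≡ p ^ e * u × ¬ p ∣ u)
  step : ∀ n → (∀ {m} → m < n → .{{_ : NonZero m}} → Split m) → .{{_ : NonZero n}} → Split n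
  step n rec with p ∣? n
  ... | no p∤n = 0 , n , sym (ℕ.*-identityˡ n) , p∤n
  ... | yes p∣n@(divides q n≡q*p) with rec (quotient-< p∣n) {{quotient≢0 p∣n}}
  ...   | e , u , q≡p^e*u , p∤u = suc e , u , (begin
    n                ≡⟨ n≡q*p ⟩
    q * p            ≡⟨ cong (_* p) q≡p^e*u ⟩
    p ^ e * u * p    ≡⟨ ℕ.*-comm (p ^ e * u) p ⟩
    p * (p ^ e * u)  ≡⟨ sym (ℕ.*-assoc p (p ^ e) u) ⟩
    p ^ suc e * u    ∎) , p∤u
    where open ≡-Reasoning

prime-power-part-∣ : ∀ {p k e w c} → Prime p → ¬ p ∣ w → ¬ p ^ 2 ∣ c →
                     p ^ k * w ∣ p ^ e * c → k ≤ suc e × w ∣ c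
prime-power-part-∣ {p} {k} {e} {w} {c} pp p∤w p²∤c p^k*w∣p^e*c = k≤1+e , w∣c
  where
  instance _ = prime⇒nonZero pp
  w∣c : w ∣ c
  w∣c = coprime-divisor (Coprime-sym (coprime-^ (prime∤⇒coprime pp p∤w) e)) (m*n∣⇒n∣ (p ^ k) w p^k*w∣p^e*c)
  k≤1+e : k ≤ suc e
  k≤1+e = ℕ.≮⇒≥ λ 1+e<k → p²∤c (*-cancelʳ-∣ (p ^ e) {{ℕ.m^n≢0 p e}} (begin
    p ^ 2 * p ^ e   ≡⟨ sym (ℕ.^-distribˡ-+-* p 2 e) ⟩
    p ^ (2 + e)     ∣⟨ ^-monoʳ-∣ p 1+e<k ⟩
    p ^ k           ∣⟨ m*n∣⇒m∣ (p ^ k) w p^k*w∣p^e*c ⟩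
    p ^ e * c       ≡⟨ ℕ.*-comm (p ^ e) c ⟩
    c * p ^ e       ∎))
    where open ∣-Reasoning

¬2∣⇒odd : ∀ n → ¬ 2 ∣ n → ∃[ k ] n ≡ suc (k * 2)
¬2∣⇒odd zero          2∤0   = contradiction (divides 0 refl) 2∤0
¬2∣⇒odd (suc zero)    _     = 0 , refl
¬2∣⇒odd (suc (suc n)) 2∤2+n with ¬2∣⇒odd n (λ 2∣n → 2∤2+n (∣m∣n⇒∣m+n ∣-refl 2∣n))
... | k , n≡1+2k = suc k , cong (λ t → suc (suc t)) n≡1+2k

prime>1 : ∀ {p} → Prime p → 1 < p
prime>1 {p} pp = nonTrivial⇒n>1 p {{prime⇒nonTrivial pp}}

∣⇒≢0 : ∀ {m n} .{{_ : NonZero n}} → m ∣ n → NonZero m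
∣⇒≢0 {n = n} m∣n = ≢-nonZero λ { refl → ≢-nonZero⁻¹ n (0∣⇒≡0 m∣n) }

suc-n<n^2 : ∀ {n} → 2 ≤ n → suc n < n ^ 2
suc-n<n^2 {n} 2≤n = begin-strict
  suc n          <⟨ ℕ.n<1+n (suc n) ⟩
  2 + n          ≤⟨ ℕ.+-monoˡ-≤ n 2≤n ⟩
  n + n          ≡⟨ cong (λ k → n + k) (sym (ℕ.+-identityʳ n)) ⟩
  2 * n          ≤⟨ ℕ.*-monoˡ-≤ n 2≤n ⟩
  n * n          ≡⟨ cong (λ k → n * k) (sym (ℕ.*-identityʳ n)) ⟩
  n ^ 2          ∎
  where open ℕ.≤-Reasoning

odd-prime⇒2∣suc : ∀ {p} → Prime p → 3 ≤ p → 2 ∣ suc p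
odd-prime⇒2∣suc {p} pp 3≤p with ¬2∣⇒odd p (λ 2∣p → ℕ.<⇒≢ 3≤p (prime∣prime⇒≡ prime[2] pp 2∣p))
... | k , p≡1+2k = divides (suc k) (cong suc p≡1+2k)

-- Congruences of integers

infix 4 _≡ᶻ_[mod_]

-- A record, unlike Defs._≡_[mod_], so that both sides and the modulus are inferable.
record _≡ᶻ_[mod_] (a b : ℤ) (m : ℕ) : Set where
  constructor mod-intro
  field m∣a-b : + m Signed.∣ a -ᶻ b

open _≡ᶻ_[mod_] public

module _ {m : ℕ} where

  private
    rearrange : ∀ {x y} → x ≡ y → + m Signed.∣ x → + m Signed.∣ y
    rearrange refl d = d

  ≡ᶻ-reflexive : ∀ {a b} → a ≡ b → a ≡ᶻ b [mod m ]
  ≡ᶻ-reflexive {a} refl = mod-intro (Signed.divides 0ℤ (trans (ℤ.+-inverseʳ a) (sym (ℤ.*-zeroˡ (+ m)))))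

  ≡ᶻ-refl : ∀ {a} → a ≡ᶻ a [mod m ]
  ≡ᶻ-refl = ≡ᶻ-reflexive refl

  ≡ᶻ-sym : ∀ {a b} → a ≡ᶻ b [mod m ] → b ≡ᶻ a [mod m ]
  ≡ᶻ-sym {a} {b} (mod-intro d) = mod-intro (rearrange (identity a b) (Signed.∣m⇒∣-m d))
    where
    identity : ∀ a b → -ᶻ (a -ᶻ b) ≡ b -ᶻ a
    identity = solve-∀

  ≡ᶻ-trans : ∀ {a b c} → a ≡ᶻ b [mod m ] → b ≡ᶻ c [mod m ] → a ≡ᶻ c [mod m ]
  ≡ᶻ-trans {a} {b} {c} (mod-intro d) (mod-intro e) = mod-intro (rearrange (identity a b c) (Signed.∣m∣n⇒∣m+n d e))
    where
    identity : ∀ a b c → (a -ᶻ b) +ᶻ (b -ᶻ c) ≡ a -ᶻ c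
    identity = solve-∀

  +-cong : ∀ {a b c d} → a ≡ᶻ b [mod m ] → c ≡ᶻ d [mod m ] → a +ᶻ c ≡ᶻ b +ᶻ d [mod m ]
  +-cong {a} {b} {c} {d} (mod-intro x) (mod-intro y) = mod-intro (rearrange (identity a b c d) (Signed.∣m∣n⇒∣m+n x y))
    where
    identity : ∀ a b c d → (a -ᶻ b) +ᶻ (c -ᶻ d) ≡ (a +ᶻ c) -ᶻ (b +ᶻ d)
    identity = solve-∀

  *-cong : ∀ {a b c d} → a ≡ᶻ b [mod m ] → c ≡ᶻ d [mod m ] → a *ᶻ c ≡ᶻ b *ᶻ d [mod m ]
  *-cong {a} {b} {c} {d} (mod-intro x) (mod-intro y) =
    mod-intro (rearrange (identity a b c d) (Signed.∣m∣n⇒∣m+n (Signed.∣n⇒∣m*n a y) (Signed.∣n⇒∣m*n d x)))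
    where
    identity : ∀ a b c d → a *ᶻ (c -ᶻ d) +ᶻ d *ᶻ (a -ᶻ b) ≡ a *ᶻ c -ᶻ b *ᶻ d
    identity = solve-∀

  neg-cong : ∀ {a b} → a ≡ᶻ b [mod m ] → -ᶻ a ≡ᶻ -ᶻ b [mod m ]
  neg-cong {a} {b} (mod-intro d) = mod-intro (rearrange (identity a b) (Signed.∣m⇒∣-m d))
    where
    identity : ∀ a b → -ᶻ (a -ᶻ b) ≡ -ᶻ a -ᶻ -ᶻ b
    identity = solve-∀

  sub-cong : ∀ {a b c d} → a ≡ᶻ b [mod m ] → c ≡ᶻ d [mod m ] → a -ᶻ c ≡ᶻ b -ᶻ d [mod m ]
  sub-cong a≡b c≡d = +-cong a≡b (neg-cong c≡d)

  ≡ᶻ-isEquivalence : IsEquivalence (λ a b → a ≡ᶻ b [mod m ])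
  ≡ᶻ-isEquivalence = record { refl = ≡ᶻ-refl ; sym = ≡ᶻ-sym ; trans = ≡ᶻ-trans }

  multiple≡ᶻ0 : ∀ t → t *ᶻ + m ≡ᶻ 0ℤ [mod m ]
  multiple≡ᶻ0 t = mod-intro (Signed.divides t (ℤ.+-identityʳ (t *ᶻ + m)))

  +-multiple : ∀ a t → a +ᶻ t *ᶻ + m ≡ᶻ a [mod m ]
  +-multiple a t = ≡ᶻ-trans (+-cong (≡ᶻ-refl {a = a}) (multiple≡ᶻ0 t)) (≡ᶻ-reflexive (ℤ.+-identityʳ a))

  %ℕ-≡ᶻ : .{{_ : NonZero m}} → ∀ a → + (a %ℕ m) ≡ᶻ a [mod m ]
  %ℕ-≡ᶻ a = mod-intro (Signed.divides (-ᶻ (a /ℕ m)) (begin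
    + (a %ℕ m) -ᶻ a                                   ≡⟨ cong (λ t → + (a %ℕ m) -ᶻ t) (a≡a%ℕn+[a/ℕn]*n a m) ⟩
    + (a %ℕ m) -ᶻ (+ (a %ℕ m) +ᶻ (a /ℕ m) *ᶻ + m)    ≡⟨ identity (+ (a %ℕ m)) (a /ℕ m) (+ m) ⟩
    -ᶻ (a /ℕ m) *ᶻ + m                                ∎))
    where
    open ≡-Reasoning
    identity : ∀ r q m → r -ᶻ (r +ᶻ q *ᶻ m) ≡ -ᶻ q *ᶻ m
    identity = solve-∀

  residue : .{{_ : NonZero m}} → ℤ → Fin m
  residue a = fromℕ< (n%ℕd<d a m)

  residue-injective : .{{_ : NonZero m}} → ∀ {a b} → residue a ≡ residue b → a ≡ᶻ b [mod m ]
  residue-injective {a} {b} eq = ≡ᶻ-trans (≡ᶻ-sym (%ℕ-≡ᶻ a)) (≡ᶻ-trans (≡ᶻ-reflexive (cong +_ a%m≡b%m)) (%ℕ-≡ᶻ b))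
    where
    a%m≡b%m : a %ℕ m ≡ b %ℕ m
    a%m≡b%m = trans (sym (toℕ-fromℕ< (n%ℕd<d a m))) (trans (cong toℕ eq) (toℕ-fromℕ< (n%ℕd<d b m)))

  ≡ᶻ⇒offset : ∀ {a b} → a ≡ᶻ b [mod m ] → ∃[ t ] a ≡ b +ᶻ t *ᶻ + m
  ≡ᶻ⇒offset {a} {b} (mod-intro (Signed.divides t a-b≡t*m)) = t , trans (identity a b) (cong (b +ᶻ_) a-b≡t*m)
    where
    identity : ∀ a b → a ≡ b +ᶻ (a -ᶻ b)
    identity = solve-∀

  _≡ᶻ?_ : ∀ a b → Dec (a ≡ᶻ b [mod m ])
  a ≡ᶻ? b = Dec.map′ mod-intro m∣a-b (+ m Signed.∣? a -ᶻ b)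

≡ᶻ-setoid : ℕ → Setoid _ _
≡ᶻ-setoid m = record { isEquivalence = ≡ᶻ-isEquivalence {m} }

module ≡ᶻ-Reasoning (m : ℕ) = SetoidReasoning (≡ᶻ-setoid m)

≡ᶻ-weaken : ∀ {d m a b} → d ∣ m → a ≡ᶻ b [mod m ] → a ≡ᶻ b [mod d ]
≡ᶻ-weaken d∣m (mod-intro m∣a-b) = mod-intro (Signed.∣-trans (Signed.∣ᵤ⇒∣ d∣m) m∣a-b)

≡ᶻ-lcm : ∀ {m n a b} → a ≡ᶻ b [mod m ] → a ≡ᶻ b [mod n ] → a ≡ᶻ b [mod lcm m n ]
≡ᶻ-lcm (mod-intro m∣a-b) (mod-intro n∣a-b) = mod-intro (Signed.∣ᵤ⇒∣ (lcm-least (Signed.∣⇒∣ᵤ m∣a-b) (Signed.∣⇒∣ᵤ n∣a-b)))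

≡ᶻ-mod-1 : ∀ {a b} → a ≡ᶻ b [mod 1 ]
≡ᶻ-mod-1 = mod-intro (Signed.∣ᵤ⇒∣ (1∣ _))

≡ᶻ0⇒∣ : ∀ {m a} → + a ≡ᶻ 0ℤ [mod m ] → m ∣ a
≡ᶻ0⇒∣ {m} {a} (mod-intro m∣a-0) = subst (m ∣_) (ℕ.+-identityʳ a) (Signed.∣⇒∣ᵤ m∣a-0)

∣⇒≡ᶻ0 : ∀ {m a} → m ∣ a → + a ≡ᶻ 0ℤ [mod m ]
∣⇒≡ᶻ0 {m} {a} m∣a = mod-intro (Signed.∣ᵤ⇒∣ (subst (m ∣_) (sym (ℕ.+-identityʳ a)) m∣a))

private
  toℤ-1+*≡* : ∀ b c d e → 1 + b * c ≡ d * e → 1ℤ +ᶻ + b *ᶻ + c ≡ + d *ᶻ + e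
  toℤ-1+*≡* b c d e eq = trans (cong (1ℤ +ᶻ_) (sym (ℤ.pos-* b c))) (trans (cong +_ eq) (ℤ.pos-* d e))

inverse-mod-prime : ∀ {p a} → Prime p → ¬ p ∣ a → ∃[ u ] u *ᶻ + a ≡ᶻ 1ℤ [mod p ]
inverse-mod-prime {p} {a} pp p∤a with coprime-Bézout (prime∤⇒coprime pp p∤a)
... | Bézout.+- x y 1+y*a≡x*p = -ᶻ + y , mod-intro (Signed.divides (-ᶻ + x) (begin
  -ᶻ + y *ᶻ + a -ᶻ 1ℤ           ≡⟨ identity (+ y) (+ a) ⟩
  -ᶻ (1ℤ +ᶻ + y *ᶻ + a)         ≡⟨ cong -ᶻ_ (toℤ-1+*≡* y a x p 1+y*a≡x*p) ⟩
  -ᶻ (+ x *ᶻ + p)               ≡⟨ ℤ.neg-distribˡ-* (+ x) (+ p) ⟩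
  -ᶻ + x *ᶻ + p                 ∎))
  where
  open ≡-Reasoning
  identity : ∀ y a → -ᶻ y *ᶻ a -ᶻ 1ℤ ≡ -ᶻ (1ℤ +ᶻ y *ᶻ a)
  identity = solve-∀
... | Bézout.-+ x y 1+x*p≡y*a = + y , mod-intro (Signed.divides (+ x) (begin
  + y *ᶻ + a -ᶻ 1ℤ              ≡⟨ cong (_-ᶻ 1ℤ) (sym (toℤ-1+*≡* x p y a 1+x*p≡y*a)) ⟩
  1ℤ +ᶻ + x *ᶻ + p -ᶻ 1ℤ        ≡⟨ identity (+ x *ᶻ + p) ⟩
  + x *ᶻ + p                    ∎))
  where
  open ≡-Reasoning
  identity : ∀ t → 1ℤ +ᶻ t -ᶻ 1ℤ ≡ t
  identity = solve-∀

-1^n*-1^n≡1 : ∀ n → -1ℤ ^ᶻ n *ᶻ -1ℤ ^ᶻ n ≡ 1ℤ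
-1^n*-1^n≡1 zero    = refl
-1^n*-1^n≡1 (suc n) = trans (identity (-1ℤ ^ᶻ n)) (-1^n*-1^n≡1 n)
  where
  identity : ∀ x → (-1ℤ *ᶻ x) *ᶻ (-1ℤ *ᶻ x) ≡ x *ᶻ x
  identity = solve-∀

-1^[k*2]≡1 : ∀ k → -1ℤ ^ᶻ (k * 2) ≡ 1ℤ
-1^[k*2]≡1 zero    = refl
-1^[k*2]≡1 (suc k) = trans (identity (-1ℤ ^ᶻ (k * 2))) (-1^[k*2]≡1 k)
  where
  identity : ∀ x → -1ℤ *ᶻ (-1ℤ *ᶻ x) ≡ x
  identity = solve-∀

-- The K-Fibonacci sequence and its Pisano periods

module KFibonacci (K : ℕ) where

  F : ℕ → ℤ
  F n = + kfib K n

  F-rec : ∀ n → F (suc (suc n)) ≡ + K *ᶻ F (suc n) +ᶻ F n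
  F-rec n = trans (ℤ.pos-+ (K * kfib K (suc n)) (kfib K n)) (cong (_+ᶻ F n) (ℤ.pos-* K (kfib K (suc n))))

  F-rec⁻¹ : ∀ n → F n ≡ F (suc (suc n)) -ᶻ + K *ᶻ F (suc n)
  F-rec⁻¹ n = trans (identity (F n) (+ K *ᶻ F (suc n))) (cong (_-ᶻ + K *ᶻ F (suc n)) (sym (F-rec n)))
    where
    identity : ∀ x y → x ≡ (y +ᶻ x) -ᶻ y
    identity = solve-∀

  F-add : ∀ a b → F (a + suc b) ≡ F (suc a) *ᶻ F (suc b) +ᶻ F a *ᶻ F b
  F-add zero    b = sym (identity (F (suc b)) (F b))
    where
    identity : ∀ x y → 1ℤ *ᶻ x +ᶻ 0ℤ *ᶻ y ≡ x
    identity = solve-∀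
  F-add (suc a) b = begin
    F (suc a + suc b)                                         ≡⟨ cong F (sym (ℕ.+-suc a (suc b))) ⟩
    F (a + suc (suc b))                                       ≡⟨ F-add a (suc b) ⟩
    F (suc a) *ᶻ F (suc (suc b)) +ᶻ F a *ᶻ F (suc b)          ≡⟨ cong (λ t → F (suc a) *ᶻ t +ᶻ F a *ᶻ F (suc b)) (F-rec b) ⟩
    F (suc a) *ᶻ (+ K *ᶻ F (suc b) +ᶻ F b) +ᶻ F a *ᶻ F (suc b) ≡⟨ identity (+ K) (F (suc a)) (F a) (F (suc b)) (F b) ⟩
    (+ K *ᶻ F (suc a) +ᶻ F a) *ᶻ F (suc b) +ᶻ F (suc a) *ᶻ F b ≡⟨ cong (λ t → t *ᶻ F (suc b) +ᶻ F (suc a) *ᶻ F b) (sym (F-rec a)) ⟩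
    F (suc (suc a)) *ᶻ F (suc b) +ᶻ F (suc a) *ᶻ F b          ∎
    where
    open ≡-Reasoning
    identity : ∀ k x y u v → x *ᶻ (k *ᶻ u +ᶻ v) +ᶻ y *ᶻ u ≡ (k *ᶻ x +ᶻ y) *ᶻ u +ᶻ x *ᶻ v
    identity = solve-∀

  d'Ocagne : ∀ i d → F (suc i) *ᶻ F (i + d) -ᶻ F i *ᶻ F (suc (i + d)) ≡ -1ℤ ^ᶻ i *ᶻ F d
  d'Ocagne zero    d = identity (F d) (F (suc d))
    where
    identity : ∀ x y → 1ℤ *ᶻ x -ᶻ 0ℤ *ᶻ y ≡ 1ℤ *ᶻ x
    identity = solve-∀
  d'Ocagne (suc i) d = begin
    F (suc (suc i)) *ᶻ F (suc (i + d)) -ᶻ F (suc i) *ᶻ F (suc (suc (i + d)))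
      ≡⟨ cong₂ (λ s t → s *ᶻ F (suc (i + d)) -ᶻ F (suc i) *ᶻ t) (F-rec i) (F-rec (i + d)) ⟩
    (+ K *ᶻ F (suc i) +ᶻ F i) *ᶻ F (suc (i + d)) -ᶻ F (suc i) *ᶻ (+ K *ᶻ F (suc (i + d)) +ᶻ F (i + d))
      ≡⟨ identity (+ K) (F (suc i)) (F i) (F (suc (i + d))) (F (i + d)) ⟩
    -1ℤ *ᶻ (F (suc i) *ᶻ F (i + d) -ᶻ F i *ᶻ F (suc (i + d)))
      ≡⟨ cong (-1ℤ *ᶻ_) (d'Ocagne i d) ⟩
    -1ℤ *ᶻ (-1ℤ ^ᶻ i *ᶻ F d)
      ≡⟨ sym (ℤ.*-assoc -1ℤ (-1ℤ ^ᶻ i) (F d)) ⟩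
    -1ℤ ^ᶻ suc i *ᶻ F d ∎
    where
    open ≡-Reasoning
    identity : ∀ k a b c u → (k *ᶻ a +ᶻ b) *ᶻ c -ᶻ a *ᶻ (k *ᶻ c +ᶻ u) ≡ -1ℤ *ᶻ (a *ᶻ u -ᶻ b *ᶻ c)
    identity = solve-∀

  cassini : ∀ i → F (suc i) *ᶻ F (suc i) -ᶻ F i *ᶻ F (suc (suc i)) ≡ -1ℤ ^ᶻ i
  cassini i = begin
    F (suc i) *ᶻ F (suc i) -ᶻ F i *ᶻ F (suc (suc i))  ≡⟨ cong (λ j → F (suc i) *ᶻ F j -ᶻ F i *ᶻ F (suc j)) (ℕ.+-comm 1 i) ⟩
    F (suc i) *ᶻ F (i + 1) -ᶻ F i *ᶻ F (suc (i + 1))  ≡⟨ d'Ocagne i 1 ⟩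
    -1ℤ ^ᶻ i *ᶻ 1ℤ                                     ≡⟨ ℤ.*-identityʳ (-1ℤ ^ᶻ i) ⟩
    -1ℤ ^ᶻ i                                           ∎
    where open ≡-Reasoning

  ShiftInvariant : ℕ → ℕ → Set
  ShiftInvariant m d = ∀ n → F (n + d) ≡ᶻ F n [mod m ]

  record Returns (m d : ℕ) : Set where
    constructor returns
    field
      F[d]≡0   : F d ≡ᶻ 0ℤ [mod m ]
      F[1+d]≡1 : F (suc d) ≡ᶻ 1ℤ [mod m ]

  Period : ℕ → ℕ → Set
  Period m p = 0 < p × Returns m p

  returns? : ∀ m d → Dec (Returns m d)
  returns? m d = Dec.map′ (λ (x , y) → returns x y) (λ (returns x y) → x , y) ((F d ≡ᶻ? 0ℤ) ×-dec (F (suc d) ≡ᶻ? 1ℤ))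

  shiftInvariant⇒returns : ∀ {m d} → ShiftInvariant m d → Returns m d
  shiftInvariant⇒returns inv = returns (inv 0) (inv 1)

  returns⇒shiftInvariant : ∀ {m d} → Returns m d → ShiftInvariant m d
  returns⇒shiftInvariant {m} {d} (returns Fd≡0 F1+d≡1) = go
    where
    open ≡ᶻ-Reasoning m
    go : ShiftInvariant m d
    go zero    = Fd≡0
    go (suc n) = begin
      F (suc n + d)                                ≡⟨ cong F (ℕ.+-comm (suc n) d) ⟩
      F (d + suc n)                                ≡⟨ F-add d n ⟩
      F (suc d) *ᶻ F (suc n) +ᶻ F d *ᶻ F n         ≈⟨ +-cong (*-cong F1+d≡1 ≡ᶻ-refl) (*-cong Fd≡0 ≡ᶻ-refl) ⟩
      1ℤ *ᶻ F (suc n) +ᶻ 0ℤ *ᶻ F n                 ≡⟨ identity (F (suc n)) (F n) ⟩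
      F (suc n)                                    ∎
      where
      identity : ∀ x y → 1ℤ *ᶻ x +ᶻ 0ℤ *ᶻ y ≡ x
      identity = solve-∀

  shiftInvariant-+ : ∀ {m d e} → ShiftInvariant m d → ShiftInvariant m e → ShiftInvariant m (d + e)
  shiftInvariant-+ {m} {d} {e} inv-d inv-e n = begin
    F (n + (d + e))  ≡⟨ cong F (sym (ℕ.+-assoc n d e)) ⟩
    F (n + d + e)    ≈⟨ inv-e (n + d) ⟩
    F (n + d)        ≈⟨ inv-d n ⟩
    F n              ∎
    where open ≡ᶻ-Reasoning m

  shiftInvariant-* : ∀ {m d} → ShiftInvariant m d → ∀ k → ShiftInvariant m (k * d)
  shiftInvariant-* inv zero    n = ≡ᶻ-reflexive (cong F (ℕ.+-identityʳ n))
  shiftInvariant-* inv (suc k) = shiftInvariant-+ inv (shiftInvariant-* inv k)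

  shiftInvariant-cancel : ∀ {m d e} → ShiftInvariant m d → ShiftInvariant m (e + d) → ShiftInvariant m e
  shiftInvariant-cancel {m} {d} {e} inv-d inv-e+d n = begin
    F (n + e)        ≈⟨ inv-d (n + e) ⟨
    F (n + e + d)    ≡⟨ cong F (ℕ.+-assoc n e d) ⟩
    F (n + (e + d))  ≈⟨ inv-e+d n ⟩
    F n              ∎
    where open ≡ᶻ-Reasoning m

  returns-descend : ∀ {m} i d → F (i + d) ≡ᶻ F i [mod m ] → F (suc i + d) ≡ᶻ F (suc i) [mod m ] → Returns m d
  returns-descend zero    d F[d]≡F0 F[1+d]≡F1 = returns F[d]≡F0 F[1+d]≡F1
  returns-descend {m} (suc i) d F[1+i+d]≡F[1+i] F[2+i+d]≡F[2+i] = returns-descend i d F[i+d]≡F[i] F[1+i+d]≡F[1+i]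
    where
    open ≡ᶻ-Reasoning m
    F[i+d]≡F[i] : F (i + d) ≡ᶻ F i [mod m ]
    F[i+d]≡F[i] = begin
      F (i + d)                                            ≡⟨ F-rec⁻¹ (i + d) ⟩
      F (suc (suc (i + d))) -ᶻ + K *ᶻ F (suc (i + d))      ≈⟨ sub-cong F[2+i+d]≡F[2+i] (*-cong (≡ᶻ-refl {a = + K}) F[1+i+d]≡F[1+i]) ⟩
      F (suc (suc i)) -ᶻ + K *ᶻ F (suc i)                  ≡⟨ F-rec⁻¹ i ⟨
      F i                                                  ∎

  ∃-period : ∀ m .{{_ : NonZero m}} → ∃ (Period m)
  ∃-period m with pigeonhole (ℕ.n<1+n (m * m)) (λ k → combine (residue (F (toℕ k))) (residue (F (suc (toℕ k)))))
  ... | i , j , i<j , same-residues = toℕ j ∸ toℕ i , ℕ.m<n⇒0<n∸m i<j ,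
        returns-descend (toℕ i) (toℕ j ∸ toℕ i)
          (agreement-at F (proj₁ same-pairs)) (agreement-at (λ n → F (suc n)) (proj₂ same-pairs))
    where
    same-pairs : residue (F (toℕ i)) ≡ residue (F (toℕ j)) × residue (F (suc (toℕ i))) ≡ residue (F (suc (toℕ j)))
    same-pairs = combine-injective (residue (F (toℕ i))) (residue (F (suc (toℕ i))))
                                   (residue (F (toℕ j))) (residue (F (suc (toℕ j)))) same-residues
    i+d≡j : toℕ i + (toℕ j ∸ toℕ i) ≡ toℕ j
    i+d≡j = ℕ.m+[n∸m]≡n (ℕ.<⇒≤ i<j)
    agreement-at : (G : ℕ → ℤ) → residue (G (toℕ i)) ≡ residue (G (toℕ j)) →
                   G (toℕ i + (toℕ j ∸ toℕ i)) ≡ᶻ G (toℕ i) [mod m ]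
    agreement-at G same = subst (λ k → G k ≡ᶻ G (toℕ i) [mod m ]) (sym i+d≡j) (≡ᶻ-sym (residue-injective same))

  period? : ∀ m d → Dec (Period m d)
  period? m d = (0 <? d) ×-dec returns? m d

  -- Opaque so that the search is never unfolded on closed moduli such as pisano 24;
  -- the value at 0 is junk and never used.
  opaque
    pisano : ℕ → ℕ
    pisano zero      = 0
    pisano m@(suc _) = proj₁ (least (period? m) (proj₂ (∃-period m)))

    pisano-isLeast : ∀ m .{{_ : NonZero m}} → Least (Period m) (pisano m)
    pisano-isLeast m@(suc _) = proj₂ (least (period? m) (proj₂ (∃-period m)))

  pisano-period : ∀ m .{{_ : NonZero m}} → Period m (pisano m)
  pisano-period m = proj₁ (pisano-isLeast m)

  pisano≢0 : ∀ m .{{_ : NonZero m}} → NonZero (pisano m)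
  pisano≢0 m = >-nonZero (proj₁ (pisano-period m))

  pisano-∣ : ∀ m {q} .{{_ : NonZero m}} → Returns m q → pisano m ∣ q
  pisano-∣ m {q} returns-q = by-remainder (q % p) refl
    where
    instance _ = pisano≢0 m
    p : ℕ
    p = pisano m
    by-remainder : ∀ r → q % p ≡ r → p ∣ q
    by-remainder zero    q%p≡0   = m%n≡0⇒n∣m q p q%p≡0
    by-remainder (suc r) q%p≡1+r = contradiction (s≤s z≤n , shiftInvariant⇒returns inv-1+r) (proj₂ (pisano-isLeast m) (suc r) 1+r<p)
      where
      q≡1+r+[q/p]*p : q ≡ suc r + q / p * p
      q≡1+r+[q/p]*p = trans (m≡m%n+[m/n]*n q p) (cong (_+ q / p * p) q%p≡1+r)
      inv-1+r : ShiftInvariant m (suc r)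
      inv-1+r = shiftInvariant-cancel (shiftInvariant-* (returns⇒shiftInvariant (proj₂ (pisano-period m))) (q / p))
                  (subst (ShiftInvariant m) q≡1+r+[q/p]*p (returns⇒shiftInvariant returns-q))
      1+r<p : suc r < p
      1+r<p = subst (_< p) q%p≡1+r (m%n<n q p)

  ∣pisano⇒returns : ∀ m {q} .{{_ : NonZero m}} → pisano m ∣ q → Returns m q
  ∣pisano⇒returns m (divides k refl) = shiftInvariant⇒returns (shiftInvariant-* (returns⇒shiftInvariant (proj₂ (pisano-period m))) k)

  returns-weaken : ∀ {a b q} → a ∣ b → Returns b q → Returns a q
  returns-weaken a∣b (returns Fq≡0 F1+q≡1) = returns (≡ᶻ-weaken a∣b Fq≡0) (≡ᶻ-weaken a∣b F1+q≡1)

  returns-lcm : ∀ {a b q} → Returns a q → Returns b q → Returns (lcm a b) q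
  returns-lcm (returns Fq≡0 F1+q≡1) (returns Fq≡0′ F1+q≡1′) = returns (≡ᶻ-lcm Fq≡0 Fq≡0′) (≡ᶻ-lcm F1+q≡1 F1+q≡1′)

  pisano-mono : ∀ {a b} .{{_ : NonZero a}} .{{_ : NonZero b}} → a ∣ b → pisano a ∣ pisano b
  pisano-mono {a} {b} a∣b = pisano-∣ a (returns-weaken a∣b (proj₂ (pisano-period b)))

  pisano-lcm : ∀ a b .{{_ : NonZero a}} .{{_ : NonZero b}} → pisano (lcm a b) ≡ lcm (pisano a) (pisano b)
  pisano-lcm a b = ∣-antisym
    (pisano-∣ (lcm a b) (returns-lcm (∣pisano⇒returns a (m∣lcm[m,n] (pisano a) (pisano b)))
                           (∣pisano⇒returns b (n∣lcm[m,n] (pisano a) (pisano b)))))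
    (lcm-least (pisano-mono (m∣lcm[m,n] a b)) (pisano-mono (n∣lcm[m,n] a b)))
    where instance _ = lcm≢0 a b

  pisano[1]≡1 : pisano 1 ≡ 1
  pisano[1]≡1 = ∣1⇒≡1 (pisano-∣ 1 (returns ≡ᶻ-mod-1 ≡ᶻ-mod-1))

  pisano-≤ : ∀ m .{{_ : NonZero m}} {q} → Period m q → pisano m ≤ q
  pisano-≤ m period-q = ℕ.≮⇒≥ λ q<p → proj₂ (pisano-isLeast m) _ q<p period-q

  least-period⇒≡pisano : ∀ m .{{_ : NonZero m}} {q} → Period m q → (∀ k → k < q → ¬ Period m k) → pisano m ≡ q
  least-period⇒≡pisano m period-q below-q =
    ℕ.≤-antisym (pisano-≤ m period-q) (ℕ.≮⇒≥ λ p<q → below-q (pisano m) p<q (pisano-period m))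

  period⇒isPeriod : ∀ {m p} → Period m p → IsPeriod K m p
  period⇒isPeriod (p>0 , returns-p) = p>0 , λ n → Signed.∣⇒∣ᵤ (m∣a-b (returns⇒shiftInvariant returns-p n))

  isPeriod⇒period : ∀ {m p} → IsPeriod K m p → Period m p
  isPeriod⇒period (p>0 , periodic) = p>0 , shiftInvariant⇒returns (λ n → mod-intro (Signed.∣ᵤ⇒∣ (periodic n)))

  pisano-isPisano : ∀ m .{{_ : NonZero m}} → IsPisano K m (pisano m)
  pisano-isPisano m = period⇒isPeriod (pisano-period m) , λ q q-isPeriod → pisano-≤ m (isPeriod⇒period q-isPeriod)

  multiples-mod-square : ∀ {M} b x y → F (suc b) ≡ x *ᶻ + M → F (suc (suc b)) ≡ 1ℤ +ᶻ y *ᶻ + M → ∀ j →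
                         F (j * suc b) ≡ᶻ 0ℤ +ᶻ + j *ᶻ x *ᶻ + M [mod M * M ] ×
                         F (suc (j * suc b)) ≡ᶻ 1ℤ +ᶻ + j *ᶻ y *ᶻ + M [mod M * M ]
  multiples-mod-square {M} b x y Fq≡xm F1+q≡1+ym = multiples
    where
    q : ℕ
    q = suc b
    m : ℤ
    m = + M
    Fb≡1+ym-Kxm : F b ≡ (1ℤ +ᶻ y *ᶻ m) -ᶻ + K *ᶻ (x *ᶻ m)
    Fb≡1+ym-Kxm = trans (F-rec⁻¹ b) (cong₂ (λ u v → u -ᶻ + K *ᶻ v) F1+q≡1+ym Fq≡xm)
    drop-square : ∀ a t → a +ᶻ t *ᶻ (m *ᶻ m) ≡ᶻ a [mod M * M ]
    drop-square a t = ≡ᶻ-trans (≡ᶻ-reflexive (cong (λ s → a +ᶻ t *ᶻ s) (sym (ℤ.pos-* M M)))) (+-multiple a t)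
    multiples : ∀ j → F (j * q) ≡ᶻ 0ℤ +ᶻ + j *ᶻ x *ᶻ m [mod M * M ] × F (suc (j * q)) ≡ᶻ 1ℤ +ᶻ + j *ᶻ y *ᶻ m [mod M * M ]
    multiples zero    = ≡ᶻ-reflexive (identity₀ x m) , ≡ᶻ-reflexive (identity₁ y m)
      where
      identity₀ : ∀ x m → 0ℤ ≡ 0ℤ +ᶻ 0ℤ *ᶻ x *ᶻ m
      identity₀ = solve-∀
      identity₁ : ∀ y m → 1ℤ ≡ 1ℤ +ᶻ 0ℤ *ᶻ y *ᶻ m
      identity₁ = solve-∀
    multiples (suc j) = F[q+jq] , F[1+q+jq]
      where
      open ≡ᶻ-Reasoning (M * M)
      Fjq : F (j * q) ≡ᶻ 0ℤ +ᶻ + j *ᶻ x *ᶻ m [mod M * M ]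
      Fjq = proj₁ (multiples j)
      F1+jq : F (suc (j * q)) ≡ᶻ 1ℤ +ᶻ + j *ᶻ y *ᶻ m [mod M * M ]
      F1+jq = proj₂ (multiples j)
      1+j≡suc-j : 1ℤ +ᶻ + j ≡ + suc j
      1+j≡suc-j = sym (ℤ.pos-+ 1 j)
      F[q+jq] : F (suc j * q) ≡ᶻ 0ℤ +ᶻ + suc j *ᶻ x *ᶻ m [mod M * M ]
      F[q+jq] = begin
        F (q + j * q)                                     ≡⟨ cong F (ℕ.+-comm q (j * q)) ⟩
        F (j * q + suc b)                                 ≡⟨ F-add (j * q) b ⟩
        F (suc (j * q)) *ᶻ F q +ᶻ F (j * q) *ᶻ F b
                                                          ≈⟨ +-cong (*-cong F1+jq (≡ᶻ-reflexive Fq≡xm)) (*-cong Fjq (≡ᶻ-reflexive Fb≡1+ym-Kxm)) ⟩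
        (1ℤ +ᶻ + j *ᶻ y *ᶻ m) *ᶻ (x *ᶻ m) +ᶻ (0ℤ +ᶻ + j *ᶻ x *ᶻ m) *ᶻ ((1ℤ +ᶻ y *ᶻ m) -ᶻ + K *ᶻ (x *ᶻ m))
                                                          ≡⟨ identity (+ j) x y m (+ K) ⟩
        0ℤ +ᶻ (1ℤ +ᶻ + j) *ᶻ x *ᶻ m +ᶻ (+ 2 *ᶻ + j *ᶻ x *ᶻ y -ᶻ + j *ᶻ + K *ᶻ x *ᶻ x) *ᶻ (m *ᶻ m)
                                                          ≈⟨ drop-square _ (+ 2 *ᶻ + j *ᶻ x *ᶻ y -ᶻ + j *ᶻ + K *ᶻ x *ᶻ x) ⟩
        0ℤ +ᶻ (1ℤ +ᶻ + j) *ᶻ x *ᶻ m                       ≡⟨ cong (λ i → 0ℤ +ᶻ i *ᶻ x *ᶻ m) 1+j≡suc-j ⟩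
        0ℤ +ᶻ + suc j *ᶻ x *ᶻ m                           ∎
        where
        identity : ∀ j x y m k → (1ℤ +ᶻ j *ᶻ y *ᶻ m) *ᶻ (x *ᶻ m) +ᶻ (0ℤ +ᶻ j *ᶻ x *ᶻ m) *ᶻ ((1ℤ +ᶻ y *ᶻ m) -ᶻ k *ᶻ (x *ᶻ m))
                                 ≡ 0ℤ +ᶻ (1ℤ +ᶻ j) *ᶻ x *ᶻ m +ᶻ (+ 2 *ᶻ j *ᶻ x *ᶻ y -ᶻ j *ᶻ k *ᶻ x *ᶻ x) *ᶻ (m *ᶻ m)
        identity = solve-∀
      F[1+q+jq] : F (suc (suc j * q)) ≡ᶻ 1ℤ +ᶻ + suc j *ᶻ y *ᶻ m [mod M * M ]
      F[1+q+jq] = begin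
        F (suc (q + j * q))                               ≡⟨ cong F (trans (cong suc (ℕ.+-comm q (j * q))) (sym (ℕ.+-suc (j * q) q))) ⟩
        F (j * q + suc q)                                 ≡⟨ F-add (j * q) q ⟩
        F (suc (j * q)) *ᶻ F (suc q) +ᶻ F (j * q) *ᶻ F q
                                                          ≈⟨ +-cong (*-cong F1+jq (≡ᶻ-reflexive F1+q≡1+ym)) (*-cong Fjq (≡ᶻ-reflexive Fq≡xm)) ⟩
        (1ℤ +ᶻ + j *ᶻ y *ᶻ m) *ᶻ (1ℤ +ᶻ y *ᶻ m) +ᶻ (0ℤ +ᶻ + j *ᶻ x *ᶻ m) *ᶻ (x *ᶻ m)
                                                          ≡⟨ identity (+ j) x y m ⟩
        1ℤ +ᶻ (1ℤ +ᶻ + j) *ᶻ y *ᶻ m +ᶻ (+ j *ᶻ y *ᶻ y +ᶻ + j *ᶻ x *ᶻ x) *ᶻ (m *ᶻ m)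
                                                          ≈⟨ drop-square _ (+ j *ᶻ y *ᶻ y +ᶻ + j *ᶻ x *ᶻ x) ⟩
        1ℤ +ᶻ (1ℤ +ᶻ + j) *ᶻ y *ᶻ m                       ≡⟨ cong (λ i → 1ℤ +ᶻ i *ᶻ y *ᶻ m) 1+j≡suc-j ⟩
        1ℤ +ᶻ + suc j *ᶻ y *ᶻ m                           ∎
        where
        identity : ∀ j x y m → (1ℤ +ᶻ j *ᶻ y *ᶻ m) *ᶻ (1ℤ +ᶻ y *ᶻ m) +ᶻ (0ℤ +ᶻ j *ᶻ x *ᶻ m) *ᶻ (x *ᶻ m)
                               ≡ 1ℤ +ᶻ (1ℤ +ᶻ j) *ᶻ y *ᶻ m +ᶻ (j *ᶻ y *ᶻ y +ᶻ j *ᶻ x *ᶻ x) *ᶻ (m *ᶻ m)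
        identity = solve-∀

  returns-lift : ∀ {M q} d → d ∣ M → Returns M q → Returns (d * M) (d * q)
  returns-lift {M} {zero}  d _   _ = subst (Returns (d * M)) (sym (ℕ.*-zeroʳ d)) (returns ≡ᶻ-refl ≡ᶻ-refl)
  returns-lift {M} {suc b} d d∣M (returns Fq≡0 F1+q≡1) =
    returns (≡ᶻ-trans (≡ᶻ-weaken dM∣MM (proj₁ multiples)) (ends-in 0ℤ x))
            (≡ᶻ-trans (≡ᶻ-weaken dM∣MM (proj₂ multiples)) (ends-in 1ℤ y))
    where
    x y : ℤ
    x = proj₁ (≡ᶻ⇒offset Fq≡0)
    y = proj₁ (≡ᶻ⇒offset F1+q≡1)
    multiples : F (d * suc b) ≡ᶻ 0ℤ +ᶻ + d *ᶻ x *ᶻ + M [mod M * M ] × F (suc (d * suc b)) ≡ᶻ 1ℤ +ᶻ + d *ᶻ y *ᶻ + M [mod M * M ]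
    multiples = multiples-mod-square b x y (trans (proj₂ (≡ᶻ⇒offset Fq≡0)) (ℤ.+-identityˡ (x *ᶻ + M)))
                                           (proj₂ (≡ᶻ⇒offset F1+q≡1)) d
    dM∣MM : d * M ∣ M * M
    dM∣MM = *-monoˡ-∣ M d∣M
    ends-in : ∀ a t → a +ᶻ + d *ᶻ t *ᶻ + M ≡ᶻ a [mod d * M ]
    ends-in a t = ≡ᶻ-trans (≡ᶻ-reflexive (cong (a +ᶻ_) (trans (identity (+ d) t (+ M)) (cong (t *ᶻ_) (sym (ℤ.pos-* d M))))))
                           (+-multiple a t)
      where
      identity : ∀ d t m → d *ᶻ t *ᶻ m ≡ t *ᶻ (d *ᶻ m)
      identity = solve-∀

  returns-^ : ∀ p .{{_ : NonZero p}} e → Returns (p ^ suc e) (p ^ e * pisano p)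
  returns-^ p zero    = subst₂ Returns (sym (ℕ.*-identityʳ p)) (sym (ℕ.*-identityˡ (pisano p))) (proj₂ (pisano-period p))
  returns-^ p (suc e) = subst (Returns (p ^ suc (suc e))) (sym (ℕ.*-assoc p (p ^ e) (pisano p)))
                          (returns-lift p (m∣m*n (p ^ e)) (returns-^ p e))

  pisano-^ : ∀ p .{{_ : NonZero p}} e → pisano (p ^ suc e) ∣ p ^ e * pisano p
  pisano-^ p e = pisano-∣ (p ^ suc e) {{ℕ.m^n≢0 p (suc e)}} (returns-^ p e)

  zero⇒shift : ∀ {m} z → F z ≡ᶻ 0ℤ [mod m ] → ∀ n → F (n + z) ≡ᶻ F (suc z) *ᶻ F n [mod m ]
  zero⇒shift {m} z Fz≡0 zero    = ≡ᶻ-trans Fz≡0 (≡ᶻ-reflexive (sym (ℤ.*-zeroʳ (F (suc z)))))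
  zero⇒shift {m} z Fz≡0 (suc n) = begin
    F (suc n + z)                                ≡⟨ cong F (ℕ.+-comm (suc n) z) ⟩
    F (z + suc n)                                ≡⟨ F-add z n ⟩
    F (suc z) *ᶻ F (suc n) +ᶻ F z *ᶻ F n         ≈⟨ +-cong (≡ᶻ-refl {a = F (suc z) *ᶻ F (suc n)}) (*-cong Fz≡0 (≡ᶻ-refl {a = F n})) ⟩
    F (suc z) *ᶻ F (suc n) +ᶻ 0ℤ *ᶻ F n          ≡⟨ identity (F (suc z)) (F (suc n)) (F n) ⟩
    F (suc z) *ᶻ F (suc n)                       ∎
    where
    open ≡ᶻ-Reasoning m
    identity : ∀ l x y → l *ᶻ x +ᶻ 0ℤ *ᶻ y ≡ l *ᶻ x
    identity = solve-∀

  zero⇒shift-* : ∀ {m} z → F z ≡ᶻ 0ℤ [mod m ] → ∀ k n → F (n + k * z) ≡ᶻ F (suc z) ^ᶻ k *ᶻ F n [mod m ]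
  zero⇒shift-* {m} z Fz≡0 zero    n = ≡ᶻ-reflexive (trans (cong F (ℕ.+-identityʳ n)) (sym (ℤ.*-identityˡ (F n))))
  zero⇒shift-* {m} z Fz≡0 (suc k) n = begin
    F (n + (z + k * z))                    ≡⟨ cong F (trans (cong (λ t → n + t) (ℕ.+-comm z (k * z))) (sym (ℕ.+-assoc n (k * z) z))) ⟩
    F (n + k * z + z)                      ≈⟨ zero⇒shift z Fz≡0 (n + k * z) ⟩
    λ′ *ᶻ F (n + k * z)                    ≈⟨ *-cong (≡ᶻ-refl {a = λ′}) (zero⇒shift-* z Fz≡0 k n) ⟩
    λ′ *ᶻ (λ′ ^ᶻ k *ᶻ F n)                 ≡⟨ sym (ℤ.*-assoc λ′ (λ′ ^ᶻ k) (F n)) ⟩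
    λ′ ^ᶻ suc k *ᶻ F n                     ∎
    where
    open ≡ᶻ-Reasoning m
    λ′ : ℤ
    λ′ = F (suc z)

  -- Cassini at z - 1 gives F (z + 1)² ≡ ±1, since F (z - 1) ≡ F (z + 1) when F z ≡ 0.
  zero⇒F[1+z]⁴≡1 : ∀ {m} w → F (suc w) ≡ᶻ 0ℤ [mod m ] → F (2 + w) ^ᶻ 4 ≡ᶻ 1ℤ [mod m ]
  zero⇒F[1+z]⁴≡1 {m} w Fz≡0 = begin
    λ′ ^ᶻ 4                          ≡⟨ identity λ′ ⟩
    -ᶻ (λ′ *ᶻ λ′) *ᶻ -ᶻ (λ′ *ᶻ λ′)   ≈⟨ *-cong -λ′²≡±1 -λ′²≡±1 ⟩
    -1ℤ ^ᶻ w *ᶻ -1ℤ ^ᶻ w             ≡⟨ -1^n*-1^n≡1 w ⟩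
    1ℤ                               ∎
    where
    open ≡ᶻ-Reasoning m
    identity : ∀ l → l *ᶻ (l *ᶻ (l *ᶻ (l *ᶻ 1ℤ))) ≡ -ᶻ (l *ᶻ l) *ᶻ -ᶻ (l *ᶻ l)
    identity = solve-∀
    λ′ : ℤ
    λ′ = F (2 + w)
    Fw≡λ′ : F w ≡ᶻ λ′ [mod m ]
    Fw≡λ′ = begin
      F w                              ≡⟨ F-rec⁻¹ w ⟩
      λ′ -ᶻ + K *ᶻ F (suc w)           ≈⟨ sub-cong (≡ᶻ-refl {a = λ′}) (*-cong (≡ᶻ-refl {a = + K}) Fz≡0) ⟩
      λ′ -ᶻ + K *ᶻ 0ℤ                  ≡⟨ cong (λ t → λ′ -ᶻ t) (ℤ.*-zeroʳ (+ K)) ⟩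
      λ′ -ᶻ 0ℤ                         ≡⟨ ℤ.+-identityʳ λ′ ⟩
      λ′                               ∎
    -λ′²≡±1 : -ᶻ (λ′ *ᶻ λ′) ≡ᶻ -1ℤ ^ᶻ w [mod m ]
    -λ′²≡±1 = begin
      -ᶻ (λ′ *ᶻ λ′)                    ≡⟨ identity₂ λ′ ⟩
      0ℤ *ᶻ 0ℤ -ᶻ λ′ *ᶻ λ′             ≈⟨ sub-cong (*-cong (≡ᶻ-sym Fz≡0) (≡ᶻ-sym Fz≡0)) (*-cong (≡ᶻ-sym Fw≡λ′) ≡ᶻ-refl) ⟩
      F (suc w) *ᶻ F (suc w) -ᶻ F w *ᶻ λ′ ≡⟨ cassini w ⟩
      -1ℤ ^ᶻ w                         ∎
      where
      identity₂ : ∀ l → -ᶻ (l *ᶻ l) ≡ 0ℤ *ᶻ 0ℤ -ᶻ l *ᶻ l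
      identity₂ = solve-∀

  zero⇒returns-4* : ∀ {m} z → F z ≡ᶻ 0ℤ [mod m ] → Returns m (4 * z)
  zero⇒returns-4* {m} zero      _    = returns ≡ᶻ-refl ≡ᶻ-refl
  zero⇒returns-4* {m} z@(suc w) Fz≡0 = shiftInvariant⇒returns λ n → begin
    F (n + 4 * z)                    ≈⟨ zero⇒shift-* z Fz≡0 4 n ⟩
    F (suc z) ^ᶻ 4 *ᶻ F n            ≈⟨ *-cong (zero⇒F[1+z]⁴≡1 w Fz≡0) ≡ᶻ-refl ⟩
    1ℤ *ᶻ F n                        ≡⟨ ℤ.*-identityˡ (F n) ⟩
    F n                              ∎
    where open ≡ᶻ-Reasoning m

  odd-return⇒∣2 : ∀ {m} k → Returns m (suc (k * 2)) → m ∣ 2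
  odd-return⇒∣2 {m} k (returns F[p]≡0 F[1+p]≡1) = ≡ᶻ0⇒∣ (sub-cong (≡ᶻ-refl {a = 1ℤ}) -1≡1)
    where
    open ≡ᶻ-Reasoning m
    F[2k]≡1 : F (k * 2) ≡ᶻ 1ℤ [mod m ]
    F[2k]≡1 = begin
      F (k * 2)                                           ≡⟨ F-rec⁻¹ (k * 2) ⟩
      F (suc (suc (k * 2))) -ᶻ + K *ᶻ F (suc (k * 2))     ≈⟨ sub-cong F[1+p]≡1 (*-cong (≡ᶻ-refl {a = + K}) F[p]≡0) ⟩
      1ℤ -ᶻ + K *ᶻ 0ℤ                                     ≡⟨ cong (λ t → 1ℤ -ᶻ t) (ℤ.*-zeroʳ (+ K)) ⟩
      1ℤ                                                  ∎
    -1≡1 : -ᶻ 1ℤ ≡ᶻ 1ℤ [mod m ]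
    -1≡1 = begin
      -ᶻ 1ℤ
        ≡⟨ refl ⟩
      0ℤ *ᶻ 0ℤ -ᶻ 1ℤ *ᶻ 1ℤ
        ≈⟨ sub-cong (*-cong (≡ᶻ-sym F[p]≡0) (≡ᶻ-sym F[p]≡0)) (*-cong (≡ᶻ-sym F[2k]≡1) (≡ᶻ-sym F[1+p]≡1)) ⟩
      F (suc (k * 2)) *ᶻ F (suc (k * 2)) -ᶻ F (k * 2) *ᶻ F (suc (suc (k * 2)))
        ≡⟨ cassini (k * 2) ⟩
      -1ℤ ^ᶻ (k * 2)
        ≡⟨ -1^[k*2]≡1 k ⟩
      1ℤ ∎

  pisano-even : ∀ m → 3 ≤ m → 2 ∣ pisano m
  pisano-even m 3≤m with 2 ∣? pisano m
  ... | yes 2∣p = 2∣p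
  ... | no  2∤p with ¬2∣⇒odd (pisano m) 2∤p
  ...   | k , p≡1+2k = contradiction (∣⇒≤ (odd-return⇒∣2 k (subst (Returns m) p≡1+2k (proj₂ (pisano-period m))))) (ℕ.<⇒≱ 3≤m)
    where instance _ = >-nonZero (ℕ.<-≤-trans (s≤s z≤n) 3≤m)

  ∃-ratio : ∀ {p} n → Prime p → ¬ F n ≡ᶻ 0ℤ [mod p ] → ∃[ ρ ] ρ *ᶻ F n ≡ᶻ F (suc n) [mod p ]
  ∃-ratio {p} n pp Fn≢0 with inverse-mod-prime pp (λ p∣Fn → Fn≢0 (∣⇒≡ᶻ0 p∣Fn))
  ... | u , u*Fn≡1 = u *ᶻ F (suc n) , (begin
    u *ᶻ F (suc n) *ᶻ F n        ≡⟨ identity u (F (suc n)) (F n) ⟩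
    u *ᶻ F n *ᶻ F (suc n)        ≈⟨ *-cong u*Fn≡1 ≡ᶻ-refl ⟩
    1ℤ *ᶻ F (suc n)              ≡⟨ ℤ.*-identityˡ (F (suc n)) ⟩
    F (suc n)                    ∎)
    where
    open ≡ᶻ-Reasoning p
    identity : ∀ u a b → u *ᶻ a *ᶻ b ≡ u *ᶻ b *ᶻ a
    identity = solve-∀

  same-ratio⇒zero : ∀ {m ρ} a d → ρ *ᶻ F a ≡ᶻ F (suc a) [mod m ] → ρ *ᶻ F (a + d) ≡ᶻ F (suc (a + d)) [mod m ] →
                    F d ≡ᶻ 0ℤ [mod m ]
  same-ratio⇒zero {m} {ρ} a d ratio-a ratio-a+d = begin
    F d                                                       ≡⟨ unsign ⟨
    s *ᶻ (s *ᶻ F d)                                           ≡⟨ cong (s *ᶻ_) (d'Ocagne a d) ⟨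
    s *ᶻ (F (suc a) *ᶻ F (a + d) -ᶻ F a *ᶻ F (suc (a + d)))   ≈⟨ *-cong (≡ᶻ-refl {a = s})
                                                                  (sub-cong (*-cong (≡ᶻ-sym ratio-a) (≡ᶻ-refl {a = F (a + d)}))
                                                                            (*-cong (≡ᶻ-refl {a = F a}) (≡ᶻ-sym ratio-a+d))) ⟩
    s *ᶻ (ρ *ᶻ F a *ᶻ F (a + d) -ᶻ F a *ᶻ (ρ *ᶻ F (a + d)))   ≡⟨ identity s ρ (F a) (F (a + d)) ⟩
    0ℤ                                                        ∎
    where
    open ≡ᶻ-Reasoning m
    s : ℤ
    s = -1ℤ ^ᶻ a
    unsign : s *ᶻ (s *ᶻ F d) ≡ F d
    unsign = trans (sym (ℤ.*-assoc s s (F d))) (trans (cong (_*ᶻ F d) (-1^n*-1^n≡1 a)) (ℤ.*-identityˡ (F d)))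
    identity : ∀ s r x y → s *ᶻ (r *ᶻ x *ᶻ y -ᶻ x *ᶻ (r *ᶻ y)) ≡ 0ℤ
    identity = solve-∀

  -- Pigeonhole on the ratios F (n + 1) / F n modulo p for n = 1 … p + 1; by d'Ocagne two equal
  -- ratios at a < b force p ∣ F (b - a).
  zero-within : ∀ {p} → Prime p → ¬ (∀ i → i < suc p → ¬ F (suc i) ≡ᶻ 0ℤ [mod p ])
  zero-within {p} pp nonzero = collide (pigeonhole (ℕ.n<1+n p) (λ i → residue (ρ i)))
    where
    instance _ = prime⇒nonZero pp
    ratio : (i : Fin (suc p)) → ∃[ ρ ] ρ *ᶻ F (suc (toℕ i)) ≡ᶻ F (suc (suc (toℕ i))) [mod p ]
    ratio i = ∃-ratio (suc (toℕ i)) pp (nonzero (toℕ i) (toℕ<n i))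
    ρ : Fin (suc p) → ℤ
    ρ i = proj₁ (ratio i)
    collide : (∃₂ λ i j → i Fin.< j × residue {p} (ρ i) ≡ residue (ρ j)) → ⊥
    collide (i , j , i<j , same-residue) with toℕ j ∸ toℕ i in j-i≡d
    ... | zero   = contradiction j-i≡d (ℕ.>⇒≢ (ℕ.m<n⇒0<n∸m i<j))
    ... | suc d′ = nonzero d′ d′<1+p (same-ratio⇒zero {ρ = ρ i} (suc (toℕ i)) (suc d′) (proj₂ (ratio i)) ratio-at-j)
      where
      i+d≡j : toℕ i + suc d′ ≡ toℕ j
      i+d≡j = trans (cong (λ k → toℕ i + k) (sym j-i≡d)) (ℕ.m+[n∸m]≡n (ℕ.<⇒≤ i<j))
      ratio-at-j : ρ i *ᶻ F (suc (toℕ i + suc d′)) ≡ᶻ F (suc (suc (toℕ i + suc d′))) [mod p ]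
      ratio-at-j = subst (λ k → ρ i *ᶻ F (suc k) ≡ᶻ F (suc (suc k)) [mod p ]) (sym i+d≡j)
                     (≡ᶻ-trans (*-cong (residue-injective {a = ρ i} {b = ρ j} same-residue) (≡ᶻ-refl {a = F (suc (toℕ j))}))
                               (proj₂ (ratio j)))
      d′<1+p : d′ < suc p
      d′<1+p = begin-strict
        d′              <⟨ ℕ.n<1+n d′ ⟩
        suc d′          ≡⟨ j-i≡d ⟨
        toℕ j ∸ toℕ i   ≤⟨ ℕ.m∸n≤m (toℕ j) (toℕ i) ⟩
        toℕ j           <⟨ toℕ<n j ⟩
        suc p           ∎
        where open ℕ.≤-Reasoning

  ∃-zero : ∀ {p} → Prime p → ∃[ z ] (0 < z × z ≤ suc p × F z ≡ᶻ 0ℤ [mod p ])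
  ∃-zero {p} pp with first-below (λ i → F (suc i) ≡ᶻ? 0ℤ) (suc p)
  ... | inj₁ (i , i<1+p , F[1+i]≡0 , _) = suc i , s≤s z≤n , i<1+p , F[1+i]≡0
  ... | inj₂ nonzero = contradiction nonzero (zero-within pp)

-- Pisano periods modulo small moduli

F-cong-K : ∀ {m K₁ K₂} → + K₁ ≡ᶻ + K₂ [mod m ] → ∀ n → KFibonacci.F K₁ n ≡ᶻ KFibonacci.F K₂ n [mod m ]
F-cong-K {m} {K₁} {K₂} K₁≡K₂ n = proj₁ (consecutive n)
  where
  open KFibonacci
  open ≡ᶻ-Reasoning m
  consecutive : ∀ n → F K₁ n ≡ᶻ F K₂ n [mod m ] × F K₁ (suc n) ≡ᶻ F K₂ (suc n) [mod m ]
  consecutive zero    = ≡ᶻ-refl , ≡ᶻ-refl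
  consecutive (suc n) = proj₂ (consecutive n) , (begin
    F K₁ (suc (suc n))                       ≡⟨ F-rec K₁ n ⟩
    + K₁ *ᶻ F K₁ (suc n) +ᶻ F K₁ n           ≈⟨ +-cong (*-cong K₁≡K₂ (proj₂ (consecutive n))) (proj₁ (consecutive n)) ⟩
    + K₂ *ᶻ F K₂ (suc n) +ᶻ F K₂ n           ≡⟨ F-rec K₂ n ⟨
    F K₂ (suc (suc n))                       ∎)

returns-cong-K : ∀ {m K₁ K₂ d} → + K₁ ≡ᶻ + K₂ [mod m ] → KFibonacci.Returns K₁ m d → KFibonacci.Returns K₂ m d
returns-cong-K {d = d} K₁≡K₂ (KFibonacci.returns F[d]≡0 F[1+d]≡1) =
  KFibonacci.returns (≡ᶻ-trans (≡ᶻ-sym (F-cong-K K₁≡K₂ d)) F[d]≡0) (≡ᶻ-trans (≡ᶻ-sym (F-cong-K K₁≡K₂ (suc d))) F[1+d]≡1)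

module PisanoOrbits (K : ℕ) where

  open KFibonacci K

  MinimalReturn : ℕ → ℕ → ℕ → Set
  MinimalReturn r m p = KFibonacci.Returns r m (suc p) × (∀ (i : Fin p) → ¬ KFibonacci.Returns r m (suc (toℕ i)))

  minimalReturn? : ∀ r m p → Dec (MinimalReturn r m p)
  minimalReturn? r m p = KFibonacci.returns? r m (suc p) ×-dec all? (λ i → ¬? (KFibonacci.returns? r m (suc (toℕ i))))

  -- The implicit table is checked by evaluation, for every residue r < m satisfying P in place of K.
  pisano-from-table : ∀ m .{{_ : NonZero m}} p {P : ℕ → Set} (P? : Decidable P) →
                      {_ : True (all? (λ (r : Fin m) → P? (toℕ r) →-dec minimalReturn? (toℕ r) m p))} →
                      P (K % m) → pisano m ≡ suc p
  pisano-from-table m p {P} P? {table} P[K%m] =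
    least-period⇒≡pisano m (s≤s z≤n , returns-cong-K K%m≡K (proj₁ minimal))
      λ { zero _ (() , _) ; (suc k) k<1+p (_ , returns-k) →
          proj₂ minimal (fromℕ< (ℕ.≤-pred k<1+p))
            (subst (KFibonacci.Returns (K % m) m) (cong suc (sym (toℕ-fromℕ< (ℕ.≤-pred k<1+p))))
                   (returns-cong-K (≡ᶻ-sym K%m≡K) returns-k)) }
    where
    K%m≡K : + (K % m) ≡ᶻ + K [mod m ]
    K%m≡K = %ℕ-≡ᶻ (+ K)
    minimal : MinimalReturn (K % m) m p
    minimal = subst (λ r → MinimalReturn r m p) (toℕ-fromℕ< (m%n<n K m))
                (toWitness table (fromℕ< (m%n<n K m)) (subst P (sym (toℕ-fromℕ< (m%n<n K m))) P[K%m]))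

  odd-residue : ∀ m .{{_ : NonZero m}} → 2 ∣ m → K % 2 ≡ 1 → K % m % 2 ≡ 1
  odd-residue m 2∣m K-odd = trans (m∣n⇒o%n%m≡o%m 2 m K 2∣m) K-odd

  pisano[2]≡3 : K % 2 ≡ 1 → pisano 2 ≡ 3
  pisano[2]≡3 = pisano-from-table 2 2 (_≟ 1)

  pisano[2]≡2 : K % 2 ≡ 0 → pisano 2 ≡ 2
  pisano[2]≡2 = pisano-from-table 2 1 (_≟ 0)

  pisano[3]≡2 : K % 3 ≡ 0 → pisano 3 ≡ 2
  pisano[3]≡2 = pisano-from-table 3 1 (_≟ 0)

  pisano[3]≡8 : K % 3 ≢ 0 → pisano 3 ≡ 8
  pisano[3]≡8 = pisano-from-table 3 7 (λ r → ¬? (r ≟ 0))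

  pisano[4]≡6 : K % 2 ≡ 1 → pisano 4 ≡ 6
  pisano[4]≡6 K-odd = pisano-from-table 4 5 (λ r → r % 2 ≟ 1) (odd-residue 4 (divides 2 refl) K-odd)

  pisano[8]≡12 : K % 2 ≡ 1 → pisano 8 ≡ 12
  pisano[8]≡12 K-odd = pisano-from-table 8 11 (λ r → r % 2 ≟ 1) (odd-residue 8 (divides 4 refl) K-odd)

  -- Orbits of π

  pisano^ : ℕ → ℕ → ℕ
  pisano^ zero    m = m
  pisano^ (suc N) m = pisano (pisano^ N m)

  pisano^≢0 : ∀ N m .{{_ : NonZero m}} → NonZero (pisano^ N m)
  pisano^≢0 zero    m = ≢-nonZero (≢-nonZero⁻¹ m)
  pisano^≢0 (suc N) m = pisano≢0 (pisano^ N m) {{pisano^≢0 N m}}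

  pisano^-shift : ∀ N m → pisano^ N (pisano m) ≡ pisano^ (suc N) m
  pisano^-shift zero    m = refl
  pisano^-shift (suc N) m = cong pisano (pisano^-shift N m)

  pisano^-lcm : ∀ N a b .{{_ : NonZero a}} .{{_ : NonZero b}} → pisano^ N (lcm a b) ≡ lcm (pisano^ N a) (pisano^ N b)
  pisano^-lcm zero    a b = refl
  pisano^-lcm (suc N) a b = trans (cong pisano (pisano^-lcm N a b))
                                  (pisano-lcm (pisano^ N a) (pisano^ N b) {{pisano^≢0 N a}} {{pisano^≢0 N b}})

  InTwoCycle : ℕ → Set
  InTwoCycle x = K % 6 ≡ 3 × (x ≡ 2 ⊎ x ≡ 3)

  Settled : ℕ → Set
  Settled x = pisano x ≡ x ⊎ InTwoCycle x

  Settles : ℕ → Set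
  Settles m = ∃[ N ] Settled (pisano^ N m)

  K≡3[6]⇒odd : K % 6 ≡ 3 → K % 2 ≡ 1
  K≡3[6]⇒odd K%6≡3 = trans (sym (m∣n⇒o%n%m≡o%m 2 6 K (divides 3 refl))) (cong (_% 2) K%6≡3)

  K≡3[6]⇒3∣K : K % 6 ≡ 3 → K % 3 ≡ 0
  K≡3[6]⇒3∣K K%6≡3 = trans (sym (m∣n⇒o%n%m≡o%m 3 6 K (divides 2 refl))) (cong (_% 3) K%6≡3)

  odd∧3∣K⇒K≡3[6] : K % 2 ≡ 1 → K % 3 ≡ 0 → K % 6 ≡ 3
  odd∧3∣K⇒K≡3[6] K-odd 3∣K = residue-6 (K % 6) (m%n<n K 6)
    (trans (m∣n⇒o%n%m≡o%m 2 6 K (divides 3 refl)) K-odd) (trans (m∣n⇒o%n%m≡o%m 3 6 K (divides 2 refl)) 3∣K)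
    where
    residue-6 : ∀ r → r < 6 → r % 2 ≡ 1 → r % 3 ≡ 0 → r ≡ 3
    residue-6 0 _ () _
    residue-6 1 _ _ ()
    residue-6 2 _ () _
    residue-6 3 _ _ _ = refl
    residue-6 4 _ () _
    residue-6 5 _ _ ()
    residue-6 (suc (suc (suc (suc (suc (suc _)))))) (s≤s (s≤s (s≤s (s≤s (s≤s (s≤s ())))))) _ _

  two-cycle : K % 6 ≡ 3 → pisano 2 ≡ 3 × pisano 3 ≡ 2
  two-cycle K%6≡3 = pisano[2]≡3 (K≡3[6]⇒odd K%6≡3) , pisano[3]≡2 (K≡3[6]⇒3∣K K%6≡3)

  settled-pisano : ∀ {x} → Settled x → Settled (pisano x)
  settled-pisano (inj₁ fixed)                  = inj₁ (cong pisano fixed)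
  settled-pisano (inj₂ (K%6≡3 , inj₁ refl)) = inj₂ (K%6≡3 , inj₂ (proj₁ (two-cycle K%6≡3)))
  settled-pisano (inj₂ (K%6≡3 , inj₂ refl)) = inj₂ (K%6≡3 , inj₁ (proj₂ (two-cycle K%6≡3)))

  settled⇒pisano²≡ : ∀ {x} → Settled x → pisano (pisano x) ≡ x
  settled⇒pisano²≡ (inj₁ fixed)                  = trans (cong pisano fixed) fixed
  settled⇒pisano²≡ (inj₂ (K%6≡3 , inj₁ refl)) = trans (cong pisano (proj₁ (two-cycle K%6≡3))) (proj₂ (two-cycle K%6≡3))
  settled⇒pisano²≡ (inj₂ (K%6≡3 , inj₂ refl)) = trans (cong pisano (proj₂ (two-cycle K%6≡3))) (proj₁ (two-cycle K%6≡3))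

  settled-later : ∀ {m N} → Settled (pisano^ N m) → ∀ k → Settled (pisano^ (k + N) m)
  settled-later settled zero    = settled
  settled-later settled (suc k) = settled-pisano (settled-later settled k)

  2∣fixed-point : ∀ {x} → 2 ≤ x → pisano x ≡ x → 2 ∣ x
  2∣fixed-point {x} 2≤x fixed with ℕ.m≤n⇒m<n∨m≡n 2≤x
  ... | inj₁ 3≤x = subst (2 ∣_) fixed (pisano-even x 3≤x)
  ... | inj₂ refl = ∣-refl

  cycle-point-∣-fixed-point : ∀ {x y} → 2 ≤ x → pisano x ≡ x → InTwoCycle y → y ∣ x
  cycle-point-∣-fixed-point 2≤x fixed (_      , inj₁ refl) = 2∣fixed-point 2≤x fixed
  cycle-point-∣-fixed-point {x} 2≤x fixed (K%6≡3 , inj₂ refl) =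
    subst₂ _∣_ (proj₁ (two-cycle K%6≡3)) fixed (pisano-mono {{_}} {{>-nonZero (ℕ.<-≤-trans (s≤s z≤n) 2≤x)}} (2∣fixed-point 2≤x fixed))

  fixed-lcm-cycle : ∀ {x y} .{{_ : NonZero x}} → pisano x ≡ x → InTwoCycle y → Settled (lcm x y)
  fixed-lcm-cycle {suc zero}      {y} _     cycle-y = inj₂ (subst InTwoCycle (trans (sym (n∣m⇒lcm[m,n]≡m (1∣ y))) (lcm-comm y 1)) cycle-y)
  fixed-lcm-cycle {x@(suc (suc _))} {y} fixed cycle-y = inj₁ (subst (λ l → pisano l ≡ l) (sym (n∣m⇒lcm[m,n]≡m y∣x)) fixed)
    where
    y∣x : y ∣ x
    y∣x = cycle-point-∣-fixed-point (s≤s (s≤s z≤n)) fixed cycle-y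

  settled-lcm : ∀ x y .{{_ : NonZero x}} .{{_ : NonZero y}} → Settled x → Settled y → Settled (lcm x y)
  settled-lcm x y (inj₁ fixed-x) (inj₁ fixed-y) = inj₁ (trans (pisano-lcm x y) (cong₂ lcm fixed-x fixed-y))
  settled-lcm x y (inj₁ fixed-x) (inj₂ cycle-y) = fixed-lcm-cycle fixed-x cycle-y
  settled-lcm x y (inj₂ cycle-x) (inj₁ fixed-y) = subst Settled (lcm-comm y x) (fixed-lcm-cycle fixed-y cycle-x)
  settled-lcm _ _ (inj₂ (K%6≡3 , inj₁ refl)) (inj₂ (_ , inj₁ refl)) = inj₂ (K%6≡3 , inj₁ refl)
  settled-lcm _ _ (inj₂ (K%6≡3 , inj₂ refl)) (inj₂ (_ , inj₂ refl)) = inj₂ (K%6≡3 , inj₂ refl)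
  settled-lcm _ _ (inj₂ (K%6≡3 , inj₁ refl)) (inj₂ (_ , inj₂ refl)) =
    inj₁ (trans (pisano-lcm 2 3) (cong₂ lcm (proj₁ (two-cycle K%6≡3)) (proj₂ (two-cycle K%6≡3))))
  settled-lcm _ _ (inj₂ (K%6≡3 , inj₂ refl)) (inj₂ (_ , inj₁ refl)) =
    inj₁ (trans (pisano-lcm 3 2) (cong₂ lcm (proj₂ (two-cycle K%6≡3)) (proj₁ (two-cycle K%6≡3))))

  settles-1 : Settles 1
  settles-1 = 0 , inj₁ pisano[1]≡1

  settles-lcm : ∀ a b .{{_ : NonZero a}} .{{_ : NonZero b}} → Settles a → Settles b → Settles (lcm a b)
  settles-lcm a b (Nᵃ , settled-a) (Nᵇ , settled-b) = Nᵇ + Nᵃ , subst Settled (sym (pisano^-lcm (Nᵇ + Nᵃ) a b))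
    (settled-lcm (pisano^ (Nᵇ + Nᵃ) a) (pisano^ (Nᵇ + Nᵃ) b) {{pisano^≢0 (Nᵇ + Nᵃ) a}} {{pisano^≢0 (Nᵇ + Nᵃ) b}}
      (settled-later settled-a Nᵇ)
      (subst (λ N → Settled (pisano^ N b)) (ℕ.+-comm Nᵃ Nᵇ) (settled-later settled-b Nᵃ)))

  settles-pisano⇒settles : ∀ {m} → Settles (pisano m) → Settles m
  settles-pisano⇒settles {m} (N , settled) = suc N , subst Settled (pisano^-shift N m) settled

  -- The orbit b of a satisfies b (n + 1) = lcm (b n) (c n) for the orbit c of w, and c is 2-periodic
  -- from N on.
  settles-of-pisano≡lcm : ∀ a w .{{_ : NonZero a}} .{{_ : NonZero w}} → pisano a ≡ lcm a w → Settles w → Settles a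
  settles-of-pisano≡lcm a w pisano-a≡lcm (N , settled-w) = 2 + N , inj₁ (begin
    b (3 + N)                      ≡⟨ step (2 + N) ⟩
    lcm (b (2 + N)) (c (2 + N))    ≡⟨ cong (lcm (b (2 + N))) (settled⇒pisano²≡ settled-w) ⟩
    lcm (b (2 + N)) (c N)          ≡⟨ n∣m⇒lcm[m,n]≡m c[N]∣b[2+N] ⟩
    b (2 + N)                      ∎)
    where
    open ≡-Reasoning
    b c : ℕ → ℕ
    b n = pisano^ n a
    c n = pisano^ n w
    step : ∀ n → b (suc n) ≡ lcm (b n) (c n)
    step n = trans (sym (pisano^-shift n a)) (trans (cong (pisano^ n) pisano-a≡lcm) (pisano^-lcm n a w))
    c[N]∣b[2+N] : c N ∣ b (2 + N)
    c[N]∣b[2+N] = ∣-trans (subst (c N ∣_) (sym (step N)) (n∣lcm[m,n] (b N) (c N)))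
                          (subst (b (suc N) ∣_) (sym (step (suc N))) (m∣lcm[m,n] (b (suc N)) (c (suc N))))

  settles-prime-power : ∀ {p c} → Prime p → pisano p ∣ c → ¬ p ^ 2 ∣ c → (∀ w → w ∣ c → ¬ p ∣ w → Settles w) →
                        ∀ e → Settles (p ^ e)
  settles-prime-power {p} {c} pp π[p]∣c p²∤c divisors-settle e = up-to e e ℕ.≤-refl
    where
    instance
      _ = prime⇒nonZero pp
      _ = prime⇒nonTrivial pp

    next : ∀ e → (∀ k → k ≤ e → Settles (p ^ k)) → Settles (p ^ suc e)
    next e settles-below with factor-out p (pisano (p ^ suc e)) {{pisano≢0 (p ^ suc e) {{ℕ.m^n≢0 p (suc e)}}}}
    ... | k , w , π≡p^k*w , p∤w = by-exponent (ℕ.m≤n⇒m<n∨m≡n (proj₁ bounds))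
      where
      instance
        _ = ℕ.m^n≢0 p (suc e)
        _ = ℕ.m^n≢0 p k
        w≢0 : NonZero w
        w≢0 = ℕ.m*n≢0⇒n≢0 (p ^ k) {{subst NonZero π≡p^k*w (pisano≢0 (p ^ suc e))}}
      bounds : k ≤ suc e × w ∣ c
      bounds = prime-power-part-∣ pp p∤w p²∤c (subst (_∣ p ^ e * c) π≡p^k*w (∣-trans (pisano-^ p e) (*-monoʳ-∣ (p ^ e) π[p]∣c)))
      π≡lcm : pisano (p ^ suc e) ≡ lcm (p ^ k) w
      π≡lcm = trans π≡p^k*w (sym (coprime⇒lcm≡* (coprime-^ (prime∤⇒coprime pp p∤w) k)))
      settles-w : Settles w
      settles-w = divisors-settle w (proj₂ bounds) p∤w
      by-exponent : k < suc e ⊎ k ≡ suc e → Settles (p ^ suc e)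
      by-exponent (inj₁ (s≤s k≤e)) =
        settles-pisano⇒settles (subst Settles (sym π≡lcm) (settles-lcm (p ^ k) w (settles-below k k≤e) settles-w))
      by-exponent (inj₂ k≡1+e) =
        settles-of-pisano≡lcm (p ^ suc e) w (subst (λ j → pisano (p ^ suc e) ≡ lcm (p ^ j) w) k≡1+e π≡lcm) settles-w

    up-to : ∀ e k → k ≤ e → Settles (p ^ k)
    up-to _       zero    _         = settles-1
    up-to (suc e) (suc k) (s≤s k≤e) with ℕ.m≤n⇒m<n∨m≡n k≤e
    ... | inj₁ k<e  = up-to e (suc k) k<e
    ... | inj₂ refl = next e (up-to e)

  settles-3 : K % 2 ≡ 1 → Settles 3
  settles-3 K-odd with K % 3 ≟ 0
  ... | yes 3∣K = 0 , inj₂ (odd∧3∣K⇒K≡3[6] K-odd 3∣K , inj₂ refl)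
  ... | no  3∤K = 3 , inj₁ (subst (λ x → pisano x ≡ x) (sym pisano³[3]≡24) pisano[24]≡24)
    where
    open ≡-Reasoning
    pisano³[3]≡24 : pisano (pisano (pisano 3)) ≡ 24
    pisano³[3]≡24 = begin
      pisano (pisano (pisano 3))   ≡⟨ cong (λ x → pisano (pisano x)) (pisano[3]≡8 3∤K) ⟩
      pisano (pisano 8)            ≡⟨ cong pisano (pisano[8]≡12 K-odd) ⟩
      pisano (lcm 4 3)             ≡⟨ pisano-lcm 4 3 ⟩
      lcm (pisano 4) (pisano 3)    ≡⟨ cong₂ lcm (pisano[4]≡6 K-odd) (pisano[3]≡8 3∤K) ⟩
      lcm 6 8                      ∎
    pisano[24]≡24 : pisano 24 ≡ 24
    pisano[24]≡24 = begin
      pisano (lcm 8 3)             ≡⟨ pisano-lcm 8 3 ⟩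
      lcm (pisano 8) (pisano 3)    ≡⟨ cong₂ lcm (pisano[8]≡12 K-odd) (pisano[3]≡8 3∤K) ⟩
      lcm 12 8                     ∎

  PrimeFactorsBelow : ℕ → ℕ → Set
  PrimeFactorsBelow b n = ∀ q → Prime q → q ∣ n → q < b

  SettlesBelow : ℕ → Set
  SettlesBelow b = ∀ n .{{_ : NonZero n}} → PrimeFactorsBelow b n → Settles n

  -- π(p^(e+1)) divides p^e · bound, so its part prime to p divides bound.
  record PisanoBound (p : ℕ) : Set where
    field
      bound                   : ℕ
      pisano∣bound            : pisano p ∣ bound
      p²∤bound                : ¬ p ^ 2 ∣ bound
      coprime-divisors-settle : ∀ w → w ∣ bound → ¬ p ∣ w → Settles w

  settlesBelow-2 : SettlesBelow 2
  settlesBelow-2 (suc zero)       _     = settles-1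
  settlesBelow-2 n@(suc (suc _)) below with ∃-prime-divisor {n} (s≤s (s≤s z≤n))
  ... | q , pq , q∣n = contradiction (prime>1 pq) (ℕ.<⇒≱ (below q pq q∣n))

  settlesBelow-composite : ∀ {b} → ¬ Prime b → SettlesBelow b → SettlesBelow (suc b)
  settlesBelow-composite ¬pb settles-below n below =
    settles-below n λ q pq q∣n → ℕ.≤∧≢⇒< (ℕ.≤-pred (below q pq q∣n)) λ { refl → ¬pb pq }

  settlesBelow-prime : ∀ {p} → Prime p → PisanoBound p → SettlesBelow p → SettlesBelow (suc p)
  settlesBelow-prime {p} pp bound settles-below n below with factor-out p {{prime⇒nonTrivial pp}} n
  ... | e , u , n≡p^e*u , p∤u =
    subst Settles (sym n≡lcm) (settles-lcm (p ^ e) u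
      (settles-prime-power pp pisano∣bound p²∤bound coprime-divisors-settle e) (settles-below u u-below))
    where
    open PisanoBound bound
    instance
      _ = ℕ.m^n≢0 p e {{prime⇒nonZero pp}}
      u≢0 : NonZero u
      u≢0 = ℕ.m*n≢0⇒n≢0 (p ^ e) {{subst NonZero n≡p^e*u (≢-nonZero (≢-nonZero⁻¹ n))}}
    u-below : PrimeFactorsBelow p u
    u-below q pq q∣u = ℕ.≤∧≢⇒< (ℕ.≤-pred (below q pq (subst (q ∣_) (sym n≡p^e*u) (∣n⇒∣m*n (p ^ e) q∣u))))
                         λ { refl → p∤u q∣u }
    n≡lcm : n ≡ lcm (p ^ e) u
    n≡lcm = trans n≡p^e*u (sym (coprime⇒lcm≡* (coprime-^ (prime∤⇒coprime pp p∤u) e)))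

  K%2≡0⊎K%2≡1 : K % 2 ≡ 0 ⊎ K % 2 ≡ 1
  K%2≡0⊎K%2≡1 with K % 2 | m%n<n K 2
  ... | 0 | _ = inj₁ refl
  ... | 1 | _ = inj₂ refl
  ... | suc (suc _) | s≤s (s≤s ())

  pisanoBound-2 : PisanoBound 2
  pisanoBound-2 with K%2≡0⊎K%2≡1
  ... | inj₁ K-even = record
    { bound = 2 ; pisano∣bound = subst (_∣ 2) (sym (pisano[2]≡2 K-even)) ∣-refl ; p²∤bound = toWitnessFalse {a? = 4 ∣? 2} _
    ; coprime-divisors-settle = λ w w∣2 2∤w →
        [ (λ { refl → settles-1 }) , (λ { refl → contradiction ∣-refl 2∤w }) ]′ (prime⇒irreducible prime[2] w∣2) }
  ... | inj₂ K-odd = record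
    { bound = 3 ; pisano∣bound = subst (_∣ 3) (sym (pisano[2]≡3 K-odd)) ∣-refl ; p²∤bound = toWitnessFalse {a? = 4 ∣? 3} _
    ; coprime-divisors-settle = λ w w∣3 _ →
        [ (λ { refl → settles-1 }) , (λ { refl → settles-3 K-odd }) ]′ (prime⇒irreducible prime[3] w∣3) }
    where
    prime[3] : Prime 3
    prime[3] = toWitness {a? = prime? 3} _

  pisanoBound-3 : SettlesBelow 3 → PisanoBound 3
  pisanoBound-3 settles-below = record
    { bound = 8 ; pisano∣bound = pisano[3]∣8 ; p²∤bound = toWitnessFalse {a? = 9 ∣? 8} _
    ; coprime-divisors-settle = λ w w∣8 _ →
        settles-below w {{∣⇒≢0 w∣8}} λ q pq q∣w → s≤s (∣⇒≤ (prime∣^⇒∣ pq 3 (∣-trans q∣w w∣8))) }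
    where
    pisano[3]∣8 : pisano 3 ∣ 8
    pisano[3]∣8 with K % 3 ≟ 0
    ... | yes 3∣K = subst (_∣ 8) (sym (pisano[3]≡2 3∣K)) (divides 4 refl)
    ... | no  3∤K = subst (_∣ 8) (sym (pisano[3]≡8 3∤K)) ∣-refl

  pisanoBound-≥5 : ∀ {p} → Prime p → 5 ≤ p → SettlesBelow p → PisanoBound p
  pisanoBound-≥5 {p} pp 5≤p settles-below with ∃-zero pp
  ... | z , z>0 , z≤1+p , Fz≡0 = record
    { bound = 4 * z ; pisano∣bound = pisano-∣ p (zero⇒returns-4* z Fz≡0) ; p²∤bound = p²∤4z
    ; coprime-divisors-settle = λ w w∣4z p∤w → settles-below w {{∣⇒≢0 w∣4z}} (below w∣4z p∤w) }
    where
    instance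
      _ = prime⇒nonZero pp
      _ = >-nonZero z>0
      _ = ℕ.m*n≢0 4 z
    2<p : 2 < p
    2<p = ℕ.<-≤-trans (s≤s (s≤s (s≤s z≤n))) 5≤p
    p²∤4z : ¬ p ^ 2 ∣ 4 * z
    p²∤4z p²∣4z = ℕ.<⇒≱ (ℕ.≤-<-trans z≤1+p (suc-n<n^2 (ℕ.<⇒≤ 2<p))) (∣⇒≤ p²∣z)
      where
      p∤4 : ¬ p ∣ 4
      p∤4 p∣4 = ℕ.<⇒≱ 2<p (∣⇒≤ (prime∣^⇒∣ pp 2 p∣4))
      p²∣z : p ^ 2 ∣ z
      p²∣z = coprime-divisor (coprime-^ (prime∤⇒coprime pp p∤4) 2) p²∣4z
    below : ∀ {w} → w ∣ 4 * z → ¬ p ∣ w → PrimeFactorsBelow p w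
    below w∣4z p∤w q pq q∣w with euclidsLemma 4 z pq (∣-trans q∣w w∣4z)
    ... | inj₁ q∣4 = ℕ.≤-<-trans (∣⇒≤ (prime∣^⇒∣ pq 2 q∣4)) 2<p
    ... | inj₂ q∣z = ℕ.≤∧≢⇒< (ℕ.≤-pred (ℕ.≤∧≢⇒< (ℕ.≤-trans (∣⇒≤ q∣z) z≤1+p) q≢1+p)) λ { refl → p∤w q∣w }
      where
      q≢1+p : q ≢ suc p
      q≢1+p refl = ℕ.<⇒≢ (s≤s (ℕ.<⇒≤ 2<p)) (prime∣prime⇒≡ prime[2] pq (odd-prime⇒2∣suc pp 2<p))

  pisanoBound : ∀ {p} → Prime p → SettlesBelow p → PisanoBound p
  pisanoBound {2}                            _  _             = pisanoBound-2
  pisanoBound {3}                            _  settles-below = pisanoBound-3 settles-below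
  pisanoBound {4}                            p4 _             = contradiction p4 (composite⇒¬prime composite[4])
  pisanoBound {suc (suc (suc (suc (suc _))))} pp settles-below = pisanoBound-≥5 pp (s≤s (s≤s (s≤s (s≤s (s≤s z≤n))))) settles-below

  settlesBelow : ∀ b → SettlesBelow (2 + b)
  settlesBelow zero    = settlesBelow-2
  settlesBelow (suc b) with prime? (2 + b)
  ... | yes pb = settlesBelow-prime pb (pisanoBound pb (settlesBelow b)) (settlesBelow b)
  ... | no ¬pb = settlesBelow-composite ¬pb (settlesBelow b)

  settles : ∀ m .{{_ : NonZero m}} → Settles m
  settles m = settlesBelow m m λ q _ q∣m → ℕ.≤-<-trans (∣⇒≤ q∣m) (ℕ.m<n+m m (s≤s z≤n))

  pisanoIter : ∀ N m .{{_ : NonZero m}} → PisanoIter K m N (pisano^ N m)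
  pisanoIter zero    m = iter-zero
  pisanoIter (suc N) m = iter-suc (pisanoIter N m) (pisano-isPisano (pisano^ N m) {{pisano^≢0 N m}})

  settled⇒fixed-point-or-cycle : ∀ {r} .{{_ : NonZero r}} → Settled r → IsPisano K r r ⊎ InTwoCycle r
  settled⇒fixed-point-or-cycle {r} (inj₁ fixed) = inj₁ (subst (IsPisano K r) fixed (pisano-isPisano r))
  settled⇒fixed-point-or-cycle     (inj₂ cycle) = inj₂ cycle

theorem1p6 : (K : ℕ) → 1 ≤ K →
  ((m : ℕ) → 1 < m →
    ∃[ N ] ∃[ r ] (PisanoIter K m N r ×
      (IsPisano K r r ⊎ (K % 6 ≡ 3 × (r ≡ 2 ⊎ r ≡ 3)))))
  × (K % 6 ≡ 3 → IsPisano K 2 3 × IsPisano K 3 2)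
theorem1p6 K _ = orbit , two-cycle-isPisano
  where
  open KFibonacci K using (pisano-isPisano)
  open PisanoOrbits K
  orbit : (m : ℕ) → 1 < m → ∃[ N ] ∃[ r ] (PisanoIter K m N r × (IsPisano K r r ⊎ InTwoCycle r))
  orbit m@(suc _) _ with settles m
  ... | N , settled = N , pisano^ N m , pisanoIter N m , settled⇒fixed-point-or-cycle {{pisano^≢0 N m}} settled
  two-cycle-isPisano : K % 6 ≡ 3 → IsPisano K 2 3 × IsPisano K 3 2
  two-cycle-isPisano K%6≡3 = subst (IsPisano K 2) (proj₁ (two-cycle K%6≡3)) (pisano-isPisano 2) ,
                             subst (IsPisano K 3) (proj₂ (two-cycle K%6≡3)) (pisano-isPisano 3)
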